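{- For all integers $n,m$ we have $\mathfrak h_n\mathfrak h_m=\mathfrak h_m\mathfrak h_n$, $\bar{\mathfrak h}_n\bar{\mathfrak h}_m=\bar{\mathfrak h}_m\bar{\mathfrak h}_n$ and $\hat{\mathfrak h}_n\hat{\mathfrak h}_m=\hat{\mathfrak h}_m\hat{\mathfrak h}_n$ as operators on $\mathbb F[\mathbf y]$.
   Context: Let $\mathbf P$ be the poset on $\mathbb{Z}_{\ge0}\times\mathbb{Z}_{\ge1}$ with $(a,b)\prec_{\mathbf P}(c,d)$ iff $a+1<c$, or $a+1=c$ and $b\ge d$. $\mathbf C_m$ is the set of $\mathbf P$-chains $(a_1,b_1)\prec_{\mathbf P}\cdots\prec_{\mathbf P}(a_m,b_m)$ in $\mathbb{Z}_{\ge0}\times\mathbb{Z}_{\ge1}$; $\bar{\mathbf C}_m$ (resp. $\hat{\mathbf C}_m$) is the subset of chains with $a_1=0$ (resp. $a_1>0$). For a tuple $(L_1,\dots,L_r)$ of finite multisets, $\operatorname{dinv}(L_1,\dots,L_r)=\sum_{i<j}\sum_{(a,b)\in L_i,(a',b')\in L_j}\big(\chi(a=a')\chi(b>b')+\chi(a+1=a')\chi(b<b')\big)$. Let $\mathbf y=\{y_{i,j}\}_{i\ge0,j\ge1}$ be indeterminates, $\mathbb F$ a field containing $\mathbb C(q)$, and for a multiset $A$ of elements of $\mathbb{Z}_{\ge0}\times\mathbb{Z}_{\ge1}$ let $y^A=\prod_{(i,j)\in A}y_{i,j}$. Define $\mathbb F$-linear operators on $\mathbb F[\mathbf y]$ by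 $\mathfrak h_m\, y^A=\sum_{L\in\mathbf C_m}q^{\operatorname{dinv}(L,A)}y^Ly^A$, $\bar{\mathfrak h}_m\, y^A=\sum_{L\in\bar{\mathbf C}_m}q^{\operatorname{dinv}(L,A)}y^Ly^A$, $\hat{\mathfrak h}_m\, y^A=\sum_{L\in\hat{\mathbf C}_m}q^{\operatorname{dinv}(L,A)}y^Ly^A$; for $m<0$ all three are the zero operator. -}

module Defs where

open import Level using (Level)
open import Data.Bool using (Bool; true; false; _∧_; _∨_; if_then_else_)
open import Data.Nat using (ℕ; zero; suc; _⊔_; _≡ᵇ_; _<ᵇ_; _≤ᵇ_)
import Data.Nat as ℕ
open import Data.Integer using (ℤ; +_; -[1+_])
open import Data.Product using (_×_; _,_; proj₁; proj₂)
open import Data.Product.Properties using (≡-dec)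
open import Data.List using (List; []; _∷_; _++_; map; concatMap; foldr; upTo; cartesianProduct; filter; length)
open import Data.Bool.ListAction using (all)
open import Data.Nat.ListAction using (sum)
open import Relation.Nullary.Decidable using (Dec; T?)
open import Relation.Binary.PropositionalEquality using (_≡_)
open import Algebra.Bundles using (CommutativeRing)

-- Points of Z≥0 × Z≥1 are represented as pairs (a , b) of naturals;
-- the constraint b ≥ 1 is imposed explicitly where needed.

Pt : Set
Pt = ℕ × ℕ

_≟Pt_ : (x y : Pt) → Dec (x ≡ y)
_≟Pt_ = ≡-dec ℕ._≟_ ℕ._≟_

_≺ᵇ_ : Pt → Pt → Bool
(a , b) ≺ᵇ (c , d) = (suc a <ᵇ c) ∨ ((suc a ≡ᵇ c) ∧ (d ≤ᵇ b))

posᵇ : List Pt → Bool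
posᵇ = all (λ p → 1 ≤ᵇ proj₂ p)

increasingᵇ : List Pt → Bool
increasingᵇ []           = true
increasingᵇ (x ∷ [])     = true
increasingᵇ (x ∷ y ∷ xs) = (x ≺ᵇ y) ∧ increasingᵇ (y ∷ xs)

-- which family: C_m, bar C_m (a_1 = 0), hat C_m (a_1 > 0)
data Kind : Set where
  full bar hat : Kind

firstOKᵇ : Kind → List Pt → Bool
firstOKᵇ full _              = true
firstOKᵇ bar  []             = true
firstOKᵇ bar  ((a , _) ∷ _)  = a ≡ᵇ 0
firstOKᵇ hat  []             = true
firstOKᵇ hat  ((a , _) ∷ _)  = 1 ≤ᵇ a

isChainᵇ : Kind → List Pt → Bool
isChainᵇ κ L = posᵇ L ∧ increasingᵇ L ∧ firstOKᵇ κ L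

-- Multisets are represented by lists; multiset equality via counts.

count : Pt → List Pt → ℕ
count x xs = length (filter (λ y → x ≟Pt y) xs)

bagEqᵇ : List Pt → List Pt → Bool
bagEqᵇ xs ys = all (λ x → count x xs ≡ᵇ count x ys) (xs ++ ys)

-- Finite enumeration: every chain L with L ⊆ B (as multisets) has
-- coordinates bounded by the maximal coordinate of B.

bound : List Pt → ℕ
bound = foldr (λ p n → proj₁ p ⊔ proj₂ p ⊔ n) 0

box : List Pt → List Pt
box B = cartesianProduct (upTo (suc (bound B))) (upTo (suc (bound B)))

listsOfLength : ℕ → List Pt → List (List Pt)
listsOfLength zero    P = [] ∷ []
listsOfLength (suc k) P = concatMap (λ x → map (x ∷_) (listsOfLength k P)) P

-- all chains of kind κ and length m (an integer) with entries in box B;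
-- for m < 0 there are none (the operators are zero).
chainsIn : Kind → ℤ → List Pt → List (List Pt)
chainsIn κ (+ m)    B = filter (λ L → T? (isChainᵇ κ L)) (listsOfLength m (box B))
chainsIn κ -[1+ _ ] B = []

χ : Bool → ℕ
χ true  = 1
χ false = 0

dinv : List Pt → List Pt → ℕ
dinv L A = sum (map (λ p → sum (map (λ p' → pairDinv p p') A)) L)
  where
  pairDinv : Pt → Pt → ℕ
  pairDinv (a , b) (a' , b') =
    χ ((a ≡ᵇ a') ∧ (b' <ᵇ b)) ℕ.+ χ ((suc a ≡ᵇ a') ∧ (b <ᵇ b'))

module Operators {c ℓ : Level} (R : CommutativeRing c ℓ) (q : CommutativeRing.Carrier R) where
  open CommutativeRing R

  qpow : ℕ → Carrier
  qpow zero    = 1#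
  qpow (suc k) = q * qpow k

  sumR : List Carrier → Carrier
  sumR = foldr _+_ 0#

  -- coefficient of y^B in  h^κ_m y^A  =  Σ_{L ∈ C^κ_m} q^{dinv(L,A)} y^L y^A
  hCoeff : Kind → ℤ → List Pt → List Pt → Carrier
  hCoeff κ m A B =
    sumR (map (λ L → if bagEqᵇ (L ++ A) B then qpow (dinv L A) else 0#)
              (chainsIn κ m B))

  -- coefficient of y^B in  h^κ_n (h^κ_m y^A)
  --   = Σ_{L ∈ C^κ_m} q^{dinv(L,A)} · [y^B] h^κ_n (y^{L ⊎ A})
  -- (chains L not contained in B contribute 0, so restricting to the box of B is harmless)
  hhCoeff : Kind → ℤ → ℤ → List Pt → List Pt → Carrier
  hhCoeff κ n m A B =
    sumR (map (λ L → qpow (dinv L A) * hCoeff κ n (L ++ A) B)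
              (chainsIn κ m B))

module Submission where

-- Expanding the product, the coefficient of y^B in h_n h_m y^A is the sum, over pairs (L, L') of
-- an m-chain and an n-chain with L ⊎ L' ⊎ A = B, of q^(dinv(L,A) + dinv(L',A) + dinv(L',L)).
-- It therefore suffices to exchange such pairs bijectively with pairs (Q, P) of an m-chain and an
-- n-chain with Q ⊎ P = L ⊎ L' and dinv(Q,P) = dinv(L',L).
--
-- Colour the points of L and L' and merge them into one word, ordered by column and within a
-- column by decreasing second coordinate. Then only adjacent letters can form an inversion (a pair
-- counted by dinv), and adjacent letters of equal colour never do. Cut the word into maximal runs
-- of consecutive inversions; colours alternate along each run, and swapping the colours of every
-- run of even length is an involution. It keeps both colour classes chains of the same sizes and
-- turns the inversions counted by dinv(L',L) into those counted by dinv(Q,P). Since it merely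
-- redistributes points, chains from C̄ and Ĉ stay in their families.

open import Defs
open import Level using (Level)
open import Data.Integer using (ℤ)
open import Data.Nat using (_≤_)
open import Data.Product using (proj₂)
open import Data.List using (List)
open import Data.List.Relation.Unary.All using (All)
open import Algebra.Bundles using (CommutativeRing)

module Combinatorics where

  open import Data.Bool using (Bool; true; false; T; not; _∧_; if_then_else_)
  open import Data.Bool.ListAction using (all; and)
  open import Data.Bool.Properties using (T-∧; T-∨; T-≡; ⇔→≡; not-involutive; not-injective)
  open import Data.Empty using (⊥; ⊥-elim)
  import Data.Integer as ℤ
  open import Data.List using ([]; _∷_; _++_; map; length; concatMap)
  open import Data.List.Properties
    using (length-map; length-++; map-++; map-cong; ++-assoc; ∷-injective; ∷-injectiveʳ)
  open import Data.List.Membership.Propositional using (_∈_)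
  open import Data.List.Membership.Propositional.Properties
    using (∈-++⁻; ∈-++⁺ˡ; ∈-++⁺ʳ; ∈-map⁺; ∈-map⁻; ∈-filter⁺; ∈-filter⁻)
  open import Data.List.Relation.Binary.Disjoint.Propositional using (Disjoint)
  open import Data.List.Relation.Binary.Permutation.Propositional
    using (_↭_; prep; ↭-refl; ↭-trans; ↭-sym; module PermutationReasoning)
  import Data.List.Relation.Binary.Permutation.Propositional.Properties as ↭P
  open import Data.List.Relation.Unary.All using ([]; _∷_) renaming (map to All-map)
  import Data.List.Relation.Unary.All as All
  import Data.List.Relation.Unary.All.Properties as AllP
  open import Data.List.Relation.Unary.AllPairs using (AllPairs; []; _∷_)
  open import Data.List.Relation.Unary.Any using (here; there)
  open import Data.List.Relation.Unary.Linked using (Linked; []; [-]; _∷_) renaming (tail to Linked-tail)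
  open import Data.List.Relation.Unary.Linked.Properties using (Linked⇒AllPairs; AllPairs⇒Linked)
  open import Data.List.Relation.Unary.Unique.Propositional using (Unique)
  import Data.List.Relation.Unary.Unique.Propositional.Properties as Unique
  open import Data.Nat using (ℕ; zero; suc; _+_; _<_; _≡ᵇ_; _<ᵇ_; _≤ᵇ_; z≤n; s≤s)
  open import Data.Nat.ListAction using (sum)
  open import Data.Nat.ListAction.Properties using (sum-++; sum-↭)
  open import Data.Nat.Properties
    using (_≟_; _<?_; _≤?_; <-cmp; ≤-refl; ≤-reflexive; ≤-trans; <-trans; <-irrefl; <-asym; ≤-<-trans; <-≤-trans
          ; <⇒≤; <⇒≢; ≰⇒>; ≮⇒≥; ≤-pred; n<1+n; 1+n≢n; suc-injective; m≤n⇒m<n∨m≡n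
          ; ≡ᵇ⇒≡; ≡⇒≡ᵇ; <ᵇ⇒<; <⇒<ᵇ; ≤ᵇ⇒≤; ≤⇒≤ᵇ
          ; +-assoc; +-comm; +-identityʳ; +-mono-<-≤; +-commutativeSemigroup)
  open import Algebra.Properties.CommutativeSemigroup +-commutativeSemigroup
    using (x∙yz≈y∙xz; x∙yz≈z∙xy) renaming (interchange to +-interchange)
  open import Data.Product using (_×_; _,_; proj₁; ∃; uncurry)
  open import Data.Sum using (_⊎_; inj₁; inj₂)
  open import Data.Unit using (⊤; tt)
  open import Function using (_∘_)
  open import Function.Bundles using (Equivalence; mk⇔)
  open import Relation.Binary.Definitions using (tri<; tri≈; tri>)
  open import Relation.Binary.PropositionalEquality
    using (_≡_; _≢_; refl; sym; trans; cong; cong₂; subst; subst₂; module ≡-Reasoning)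
  open import Relation.Nullary using (¬_; Dec; yes; no)
  open import Relation.Nullary.Decidable using (_×-dec_; _⊎-dec_; T?)

  -- Orders and inversions on points

  infix 4 _≺_ _⊑_ _⊏_ _◁_

  _≺_ : Pt → Pt → Set
  (a , b) ≺ (c , d) = suc a < c ⊎ (suc a ≡ c × d ≤ b)

  _⊑_ : Pt → Pt → Set
  (a , b) ⊑ (c , d) = a < c ⊎ (a ≡ c × d ≤ b)

  _⊏_ : Pt → Pt → Set
  (a , b) ⊏ (c , d) = a < c ⊎ (a ≡ c × d < b)

  Inversion : Pt → Pt → Set
  Inversion (a , b) (c , d) = (a ≡ c × d < b) ⊎ (suc a ≡ c × b < d)

  _⊑?_ : ∀ u v → Dec (u ⊑ v)
  (a , b) ⊑? (c , d) = (a <? c) ⊎-dec ((a ≟ c) ×-dec (d ≤? b))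

  Inversion? : ∀ u v → Dec (Inversion u v)
  Inversion? (a , b) (c , d) = ((a ≟ c) ×-dec (d <? b)) ⊎-dec ((suc a ≟ c) ×-dec (b <? d))

  ≺⇒1+≤ : ∀ {u v} → u ≺ v → suc (proj₁ u) ≤ proj₁ v
  ≺⇒1+≤ (inj₁ 1+a<c) = <⇒≤ 1+a<c
  ≺⇒1+≤ (inj₂ (refl , _)) = ≤-refl

  ≺⇒< : ∀ {u v} → u ≺ v → proj₁ u < proj₁ v
  ≺⇒< = ≺⇒1+≤

  ≺-trans : ∀ {u v w} → u ≺ v → v ≺ w → u ≺ w
  ≺-trans u≺v v≺w = inj₁ (<-≤-trans (s≤s (≺⇒1+≤ u≺v)) (≺⇒1+≤ v≺w))

  ≺-irrefl : ∀ {u} → ¬ u ≺ u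
  ≺-irrefl u≺u = <-irrefl refl (≺⇒< u≺u)

  ⊑⇒≤ : ∀ {u v} → u ⊑ v → proj₁ u ≤ proj₁ v
  ⊑⇒≤ (inj₁ a<c) = <⇒≤ a<c
  ⊑⇒≤ (inj₂ (refl , _)) = ≤-refl

  ⊑-same-column : ∀ {u v} → u ⊑ v → proj₁ u ≡ proj₁ v → proj₂ v ≤ proj₂ u
  ⊑-same-column (inj₁ a<c) a≡c = ⊥-elim (<-irrefl a≡c a<c)
  ⊑-same-column (inj₂ (_ , d≤b)) _ = d≤b

  ⊑-trans : ∀ {u v w} → u ⊑ v → v ⊑ w → u ⊑ w
  ⊑-trans (inj₁ a<c) (inj₁ c<e) = inj₁ (<-trans a<c c<e)
  ⊑-trans (inj₁ a<c) (inj₂ (refl , _)) = inj₁ a<c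
  ⊑-trans (inj₂ (refl , _)) (inj₁ c<e) = inj₁ c<e
  ⊑-trans (inj₂ (refl , d≤b)) (inj₂ (refl , f≤d)) = inj₂ (refl , ≤-trans f≤d d≤b)

  ¬⊑⇒⊐ : ∀ u v → ¬ u ⊑ v → v ⊏ u
  ¬⊑⇒⊐ (a , b) (c , d) u⋢v with <-cmp a c
  ... | tri< a<c _ _ = ⊥-elim (u⋢v (inj₁ a<c))
  ... | tri> _ _ c<a = inj₁ c<a
  ... | tri≈ _ refl _ with d ≤? b
  ...   | yes d≤b = ⊥-elim (u⋢v (inj₂ (refl , d≤b)))
  ...   | no d≰b = inj₂ (refl , ≰⇒> d≰b)

  Inversion⇒¬≺ : ∀ {u v} → Inversion u v → ¬ u ≺ v
  Inversion⇒¬≺ (inj₁ (refl , _)) u≺v = <-irrefl refl (≺⇒< u≺v)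
  Inversion⇒¬≺ (inj₂ (refl , _)) (inj₁ 1+a<1+a) = <-irrefl refl 1+a<1+a
  Inversion⇒¬≺ (inj₂ (refl , b<d)) (inj₂ (_ , d≤b)) = <-irrefl refl (<-≤-trans b<d d≤b)

  Inversion-irrefl : ∀ {u} → ¬ Inversion u u
  Inversion-irrefl (inj₁ (_ , b<b)) = <-irrefl refl b<b
  Inversion-irrefl {a , _} (inj₂ (1+a≡a , _)) = <-irrefl (sym 1+a≡a) (n<1+n a)

  ⊑⇒¬Inversion-reversed : ∀ {u v} → u ⊑ v → ¬ Inversion v u
  ⊑⇒¬Inversion-reversed (inj₁ a<c) (inj₁ (refl , _)) = <-irrefl refl a<c
  ⊑⇒¬Inversion-reversed (inj₁ a<c) (inj₂ (refl , _)) = <-asym a<c (n<1+n _)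
  ⊑⇒¬Inversion-reversed (inj₂ (refl , d≤b)) (inj₁ (_ , b<d)) = <-irrefl refl (<-≤-trans b<d d≤b)
  ⊑⇒¬Inversion-reversed {a , _} (inj₂ (refl , _)) (inj₂ (1+a≡a , _)) = <-irrefl (sym 1+a≡a) (n<1+n a)

  ⊑∧¬Inversion⇒≺ : ∀ {u v} → u ⊑ v → ¬ Inversion u v → u ≢ v → u ≺ v
  ⊑∧¬Inversion⇒≺ {a , b} {c , d} (inj₁ a<c) ¬inv u≢v with m≤n⇒m<n∨m≡n a<c
  ... | inj₁ 1+a<c = inj₁ 1+a<c
  ... | inj₂ refl with b <? d
  ...   | yes b<d = ⊥-elim (¬inv (inj₂ (refl , b<d)))
  ...   | no b≮d = inj₂ (refl , ≮⇒≥ b≮d)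
  ⊑∧¬Inversion⇒≺ (inj₂ (refl , d≤b)) ¬inv u≢v with m≤n⇒m<n∨m≡n d≤b
  ... | inj₁ d<b = ⊥-elim (¬inv (inj₁ (refl , d<b)))
  ... | inj₂ refl = ⊥-elim (u≢v refl)

  dinvPair : Pt → Pt → ℕ
  dinvPair (a , b) (a' , b') = χ ((a ≡ᵇ a') ∧ (b' <ᵇ b)) + χ ((suc a ≡ᵇ a') ∧ (b <ᵇ b'))

  -- In `Defs` that function is local to `dinv L A` and
  -- so takes L and A as arguments; hence the unfolding of `dinv (x ∷ X) Y` does not contain that
  -- of `dinv X Y`. The two definitions agree definitionally.
  dinvSum : List Pt → List Pt → ℕ
  dinvSum L A = sum (map (λ p → sum (map (dinvPair p) A)) L)

  T-∧-intro : ∀ {x y} → T x → T y → T (x ∧ y)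
  T-∧-intro tx ty = Equivalence.from T-∧ (tx , ty)

  T-∧-elim : ∀ {x y} → T (x ∧ y) → T x × T y
  T-∧-elim = Equivalence.to T-∧

  χ-true : ∀ {b} → T b → χ b ≡ 1
  χ-true {true} _ = refl

  χ-false : ∀ {b} → ¬ T b → χ b ≡ 0
  χ-false {false} _ = refl
  χ-false {true} ¬t = ⊥-elim (¬t tt)

  dinvPair-inversion : ∀ u v → Inversion u v → dinvPair u v ≡ 1
  dinvPair-inversion (a , b) (c , d) (inj₁ (refl , d<b)) =
    cong₂ _+_ (χ-true (T-∧-intro (≡⇒≡ᵇ a a refl) (<⇒<ᵇ d<b)))
              (χ-false (λ t → 1+n≢n (≡ᵇ⇒≡ (suc a) a (proj₁ (T-∧-elim t)))))
  dinvPair-inversion (a , b) (c , d) (inj₂ (refl , b<d)) =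
    cong₂ _+_ (χ-false (λ t → 1+n≢n (sym (≡ᵇ⇒≡ a (suc a) (proj₁ (T-∧-elim t))))))
              (χ-true (T-∧-intro (≡⇒≡ᵇ (suc a) (suc a) refl) (<⇒<ᵇ b<d)))

  dinvPair-¬inversion : ∀ u v → ¬ Inversion u v → dinvPair u v ≡ 0
  dinvPair-¬inversion (a , b) (c , d) ¬inv = cong₂ _+_
    (χ-false (λ t → let (a≡c , d<b) = T-∧-elim t in ¬inv (inj₁ (≡ᵇ⇒≡ a c a≡c , <ᵇ⇒< d b d<b))))
    (χ-false (λ t → let (1+a≡c , b<d) = T-∧-elim t in ¬inv (inj₂ (≡ᵇ⇒≡ (suc a) c 1+a≡c , <ᵇ⇒< b d b<d))))

  ≺ᵇ⇒≺ : ∀ u v → T (u ≺ᵇ v) → u ≺ v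
  ≺ᵇ⇒≺ (a , b) (c , d) t with Equivalence.to T-∨ t
  ... | inj₁ 1+a<c = inj₁ (<ᵇ⇒< (suc a) c 1+a<c)
  ... | inj₂ t′ = let (1+a≡c , d≤b) = T-∧-elim t′ in inj₂ (≡ᵇ⇒≡ (suc a) c 1+a≡c , ≤ᵇ⇒≤ d b d≤b)

  ≺⇒≺ᵇ : ∀ u v → u ≺ v → T (u ≺ᵇ v)
  ≺⇒≺ᵇ (a , b) (c , d) (inj₁ 1+a<c) = Equivalence.from T-∨ (inj₁ (<⇒<ᵇ 1+a<c))
  ≺⇒≺ᵇ (a , b) (c , d) (inj₂ (1+a≡c , d≤b)) =
    Equivalence.from T-∨ (inj₂ (T-∧-intro (≡⇒≡ᵇ (suc a) c 1+a≡c) (≤⇒≤ᵇ d≤b)))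

  Positive : List Pt → Set
  Positive = All (λ p → 1 ≤ proj₂ p)

  record IsChain (κ : Kind) (L : List Pt) : Set where
    field
      positive   : Positive L
      increasing : AllPairs _≺_ L
      firstOK    : T (firstOKᵇ κ L)

  posᵇ⇒Positive : ∀ L → T (posᵇ L) → Positive L
  posᵇ⇒Positive [] _ = []
  posᵇ⇒Positive ((a , b) ∷ L) t =
    ≤ᵇ⇒≤ 1 b (proj₁ (T-∧-elim t)) ∷ posᵇ⇒Positive L (proj₂ (T-∧-elim {1 ≤ᵇ b} t))

  Positive⇒posᵇ : ∀ L → Positive L → T (posᵇ L)
  Positive⇒posᵇ [] _ = tt
  Positive⇒posᵇ ((a , b) ∷ L) (1≤b ∷ pos) = T-∧-intro (≤⇒≤ᵇ 1≤b) (Positive⇒posᵇ L pos)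

  increasingᵇ⇒Linked : ∀ L → T (increasingᵇ L) → Linked _≺_ L
  increasingᵇ⇒Linked [] _ = []
  increasingᵇ⇒Linked (x ∷ []) _ = [-]
  increasingᵇ⇒Linked (x ∷ y ∷ L) t =
    ≺ᵇ⇒≺ x y (proj₁ (T-∧-elim t)) ∷ increasingᵇ⇒Linked (y ∷ L) (proj₂ (T-∧-elim {x ≺ᵇ y} t))

  Linked⇒increasingᵇ : ∀ L → Linked _≺_ L → T (increasingᵇ L)
  Linked⇒increasingᵇ [] _ = tt
  Linked⇒increasingᵇ (x ∷ []) _ = tt
  Linked⇒increasingᵇ (x ∷ y ∷ L) (x≺y ∷ rest) = T-∧-intro (≺⇒≺ᵇ x y x≺y) (Linked⇒increasingᵇ (y ∷ L) rest)

  isChainᵇ⇒IsChain : ∀ κ L → T (isChainᵇ κ L) → IsChain κ L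
  isChainᵇ⇒IsChain κ L t = record
    { positive   = posᵇ⇒Positive L pos
    ; increasing = Linked⇒AllPairs ≺-trans (increasingᵇ⇒Linked L inc)
    ; firstOK    = first
    }
    where
    pos = proj₁ (T-∧-elim t)
    inc = proj₁ (T-∧-elim {increasingᵇ L} (proj₂ (T-∧-elim {posᵇ L} t)))
    first = proj₂ (T-∧-elim {increasingᵇ L} (proj₂ (T-∧-elim {posᵇ L} t)))

  IsChain⇒isChainᵇ : ∀ {κ L} → IsChain κ L → T (isChainᵇ κ L)
  IsChain⇒isChainᵇ {L = L} c = T-∧-intro (Positive⇒posᵇ L positive)
    (T-∧-intro (Linked⇒increasingᵇ L (AllPairs⇒Linked increasing)) firstOK)
    where open IsChain c

  -- Merging two chains into a coloured word

  -- Colour true marks points of the first chain, false those of the second.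
  Letter : Set
  Letter = Pt × Bool

  Word : Set
  Word = List Letter

  point : Letter → Pt
  point = proj₁

  colour : Letter → Bool
  colour = proj₂

  points : Word → List Pt
  points = map point

  select : Bool → Word → List Pt
  select c [] = []
  select true  ((p , true)  ∷ W) = p ∷ select true W
  select true  ((p , false) ∷ W) = select true W
  select false ((p , true)  ∷ W) = select false W
  select false ((p , false) ∷ W) = p ∷ select false W

  -- Parameterising by the merge of the tail keeps the recursion structural.
  mergeInsert : Pt → (List Pt → Word) → List Pt → Word
  mergeInsert x rest [] = (x , true) ∷ rest []
  mergeInsert x rest (y ∷ ys) with x ⊑? y
  ... | yes _ = (x , true) ∷ rest (y ∷ ys)
  ... | no _ = (y , false) ∷ mergeInsert x rest ys

  merge : List Pt → List Pt → Word
  merge [] ys = map (_, false) ys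
  merge (x ∷ xs) ys = mergeInsert x (merge xs) ys

  select-true-merge : ∀ xs ys → select true (merge xs ys) ≡ xs
  select-true-merge [] [] = refl
  select-true-merge [] (y ∷ ys) = select-true-merge [] ys
  select-true-merge (x ∷ xs) ys = go ys
    where
    go : ∀ ys → select true (mergeInsert x (merge xs) ys) ≡ x ∷ xs
    go [] = cong (x ∷_) (select-true-merge xs [])
    go (y ∷ ys) with x ⊑? y
    ... | yes _ = cong (x ∷_) (select-true-merge xs (y ∷ ys))
    ... | no _ = go ys

  select-false-merge : ∀ xs ys → select false (merge xs ys) ≡ ys
  select-false-merge [] [] = refl
  select-false-merge [] (y ∷ ys) = cong (y ∷_) (select-false-merge [] ys)
  select-false-merge (x ∷ xs) ys = go ys
    where
    go : ∀ ys → select false (mergeInsert x (merge xs) ys) ≡ ys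
    go [] = select-false-merge xs []
    go (y ∷ ys) with x ⊑? y
    ... | yes _ = select-false-merge xs (y ∷ ys)
    ... | no _ = cong (y ∷_) (go ys)

  All-merge : ∀ {P : Letter → Set} xs ys →
    All (λ x → P (x , true)) xs → All (λ y → P (y , false)) ys → All P (merge xs ys)
  All-merge [] [] _ _ = []
  All-merge [] (y ∷ ys) _ (py ∷ pys) = py ∷ All-merge [] ys [] pys
  All-merge {P} (x ∷ xs) ys (px ∷ pxs) pys = go ys pys
    where
    go : ∀ ys → All (λ y → P (y , false)) ys → All P (mergeInsert x (merge xs) ys)
    go [] _ = px ∷ All-merge xs [] pxs []
    go (y ∷ ys) (py ∷ pys) with x ⊑? y
    ... | yes _ = px ∷ All-merge xs (y ∷ ys) pxs (py ∷ pys)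
    ... | no _ = py ∷ go ys pys

  All-select : ∀ {P : Letter → Set} c W → All P W → All (λ p → P (p , c)) (select c W)
  All-select c [] [] = []
  All-select true  ((p , true)  ∷ W) (q ∷ qs) = q ∷ All-select true W qs
  All-select true  ((p , false) ∷ W) (q ∷ qs) = All-select true W qs
  All-select false ((p , true)  ∷ W) (q ∷ qs) = All-select false W qs
  All-select false ((p , false) ∷ W) (q ∷ qs) = q ∷ All-select false W qs

  _◁_ : Letter → Letter → Set
  ((a , b) , x) ◁ ((c , d) , y) = a < c ⊎ (a ≡ c × (d < b ⊎ (b ≡ d × x ≡ true × y ≡ false)))

  ◁⇒⊑ : ∀ {l l'} → l ◁ l' → point l ⊑ point l'
  ◁⇒⊑ (inj₁ a<c) = inj₁ a<c
  ◁⇒⊑ (inj₂ (refl , inj₁ d<b)) = inj₂ (refl , <⇒≤ d<b)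
  ◁⇒⊑ (inj₂ (refl , inj₂ (refl , _))) = inj₂ (refl , ≤-refl)

  ≺⇒◁ : ∀ {u v c c'} → u ≺ v → (u , c) ◁ (v , c')
  ≺⇒◁ u≺v = inj₁ (≺⇒< u≺v)

  ⊑⇒◁ : ∀ {u v} → u ⊑ v → (u , true) ◁ (v , false)
  ⊑⇒◁ (inj₁ a<c) = inj₁ a<c
  ⊑⇒◁ (inj₂ (refl , d≤b)) with m≤n⇒m<n∨m≡n d≤b
  ... | inj₁ d<b = inj₂ (refl , inj₁ d<b)
  ... | inj₂ refl = inj₂ (refl , inj₂ (refl , refl , refl))

  ⊏⇒◁ : ∀ {u v} → u ⊏ v → (u , false) ◁ (v , true)
  ⊏⇒◁ (inj₁ a<c) = inj₁ a<c
  ⊏⇒◁ (inj₂ (a≡c , d<b)) = inj₂ (a≡c , inj₁ d<b)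

  ⊏⇒≤ : ∀ {u v} → u ⊏ v → proj₁ u ≤ proj₁ v
  ⊏⇒≤ (inj₁ a<c) = <⇒≤ a<c
  ⊏⇒≤ (inj₂ (a≡c , _)) = ≤-reflexive a≡c

  ≤∘≺⇒◁ : ∀ {u v w c c'} → proj₁ u ≤ proj₁ v → v ≺ w → (u , c) ◁ (w , c')
  ≤∘≺⇒◁ a≤c v≺w = inj₁ (≤-<-trans a≤c (≺⇒< v≺w))

  SameColour≺ : Letter → Letter → Set
  SameColour≺ l l' = colour l ≡ colour l' → point l ≺ point l'

  MergePair : Letter → Letter → Set
  MergePair l l' = l ◁ l' × SameColour≺ l l'

  merge-MergePair : ∀ xs ys → AllPairs _≺_ xs → AllPairs _≺_ ys → AllPairs MergePair (merge xs ys)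
  merge-MergePair [] [] _ _ = []
  merge-MergePair [] (y ∷ ys) _ (y≺ys ∷ ys↑) = same y≺ys ∷ merge-MergePair [] ys [] ys↑
    where
    same : ∀ {zs} → All (y ≺_) zs → All (MergePair (y , false)) (map (_, false) zs)
    same [] = []
    same (y≺z ∷ y≺zs) = (≺⇒◁ y≺z , λ _ → y≺z) ∷ same y≺zs
  merge-MergePair (x ∷ xs) ys (x≺xs ∷ xs↑) ys↑ = go ys ys↑
    where
    x≺xs′ : ∀ {c} → All (λ x′ → MergePair (x , c) (x′ , c)) xs
    x≺xs′ = All-map (λ x≺x′ → ≺⇒◁ x≺x′ , λ _ → x≺x′) x≺xs
    go : ∀ ys → AllPairs _≺_ ys → AllPairs MergePair (mergeInsert x (merge xs) ys)
    go [] _ = All-merge xs [] x≺xs′ [] ∷ merge-MergePair xs [] xs↑ []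
    go (y ∷ ys) (y≺ys ∷ ys↑) with x ⊑? y
    ... | yes x⊑y =
      All-merge xs (y ∷ ys) x≺xs′
        ((⊑⇒◁ x⊑y , λ ()) ∷ All-map (λ y≺y′ → ≤∘≺⇒◁ (⊑⇒≤ x⊑y) y≺y′ , λ ()) y≺ys)
      ∷ merge-MergePair xs (y ∷ ys) xs↑ (y≺ys ∷ ys↑)
    ... | no x⋢y =
      All-merge (x ∷ xs) ys
        ((⊏⇒◁ y⊏x , λ ()) ∷ All-map (λ x≺x′ → ≤∘≺⇒◁ (⊏⇒≤ y⊏x) x≺x′ , λ ()) x≺xs)
        (All-map (λ y≺y′ → ≺⇒◁ y≺y′ , λ _ → y≺y′) y≺ys)
      ∷ go ys ys↑
      where y⊏x = ¬⊑⇒⊐ x y x⋢y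

  Independent : Pt → Pt → Set
  Independent u v = ¬ Inversion u v × u ≢ v

  ≺⇒Independent : ∀ {u v} → u ≺ v → Independent u v
  ≺⇒Independent u≺v = (λ inv → Inversion⇒¬≺ inv u≺v) , (λ { refl → ≺-irrefl u≺v })

  ≺∘⊑⇒Independent : ∀ {u v w} → u ≺ v → v ⊑ w → Independent u w
  ≺∘⊑⇒Independent {a , b} {c , d} {e , f} u≺v v⊑w = ¬inv , (λ { refl → <-irrefl refl a<e })
    where
    a<e = <-≤-trans (≺⇒< u≺v) (⊑⇒≤ v⊑w)
    ¬inv : ¬ Inversion (a , b) (e , f)
    ¬inv (inj₁ (refl , _)) = <-irrefl refl a<e
    ¬inv (inj₂ (refl , b<f)) = step u≺v
      where
      step : (a , b) ≺ (c , d) → ⊥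
      step (inj₁ 1+a<c) = <-irrefl refl (<-≤-trans 1+a<c (⊑⇒≤ v⊑w))
      step (inj₂ (refl , d≤b)) = <-irrefl refl (<-≤-trans b<f (≤-trans (⊑-same-column v⊑w refl) d≤b))

  ⊑∘≺⇒Independent : ∀ {u v w} → u ⊑ v → v ≺ w → Independent u w
  ⊑∘≺⇒Independent {a , b} {c , d} {e , f} u⊑v v≺w = ¬inv , (λ { refl → <-irrefl refl a<e })
    where
    a<e = ≤-<-trans (⊑⇒≤ u⊑v) (≺⇒< v≺w)
    ¬inv : ¬ Inversion (a , b) (e , f)
    ¬inv (inj₁ (refl , _)) = <-irrefl refl a<e
    ¬inv (inj₂ (refl , b<f)) = step v≺w
      where
      step : (c , d) ≺ (suc a , f) → ⊥
      step (inj₁ 1+c<1+a) = <-irrefl refl (≤-<-trans (⊑⇒≤ u⊑v) (≤-pred 1+c<1+a))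
      step (inj₂ (1+c≡1+a , f≤d)) =
        <-irrefl refl (<-≤-trans b<f (≤-trans f≤d (⊑-same-column u⊑v (sym (suc-injective 1+c≡1+a)))))

  -- Two of the three letters have the same colour, so their points are ≺-related.
  MergePair-Independent : ∀ {u v w} → MergePair u v → MergePair v w → MergePair u w →
    Independent (point u) (point w)
  MergePair-Independent {u} {v} {w} (u◁v , u≺v) (v◁w , v≺w) (_ , u≺w)
    with colour u | colour v | colour w
  ... | true  | _     | true  = ≺⇒Independent (u≺w refl)
  ... | false | _     | false = ≺⇒Independent (u≺w refl)
  ... | true  | true  | false = ≺∘⊑⇒Independent (u≺v refl) (◁⇒⊑ v◁w)
  ... | false | false | true  = ≺∘⊑⇒Independent (u≺v refl) (◁⇒⊑ v◁w)
  ... | true  | false | false = ⊑∘≺⇒Independent (◁⇒⊑ u◁v) (v≺w refl)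
  ... | false | true  | true  = ⊑∘≺⇒Independent (◁⇒⊑ u◁v) (v≺w refl)

  FarIndependent : List Pt → Set
  FarIndependent (x ∷ y ∷ zs) = All (Independent x) zs × FarIndependent (y ∷ zs)
  FarIndependent _ = ⊤

  AdjacentCompatible : Letter → Letter → Set
  AdjacentCompatible l l' =
    (Inversion (point l) (point l') → colour l ≢ colour l') ×
    (point l ≡ point l' → colour l ≡ true × colour l' ≡ false)

  -- The invariants of a merged pair of chains that recolouring preserves; they are what is needed
  -- to split a word back into two chains.
  record Admissible (W : Word) : Set where
    constructor admissible
    field
      sorted   : Linked _⊑_ (points W)
      far      : FarIndependent (points W)
      adjacent : Linked AdjacentCompatible W

  MergePairs⇒FarIndependent : ∀ {W} → AllPairs MergePair W → FarIndependent (points W)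
  MergePairs⇒FarIndependent [] = tt
  MergePairs⇒FarIndependent (_ ∷ []) = tt
  MergePairs⇒FarIndependent ((uv ∷ uzs) ∷ (vzs ∷ rest)) =
    zip uv uzs vzs , MergePairs⇒FarIndependent (vzs ∷ rest)
    where
    zip : ∀ {u v zs} → MergePair u v → All (MergePair u) zs → All (MergePair v) zs →
      All (Independent (point u)) (points zs)
    zip _ [] [] = []
    zip uv (uz ∷ uzs) (vz ∷ vzs) = MergePair-Independent uv vz uz ∷ zip uv uzs vzs

  MergePair⇒AdjacentCompatible : ∀ {l l'} → MergePair l l' → AdjacentCompatible l l'
  MergePair⇒AdjacentCompatible (l◁l' , same≺) = (λ inv same → Inversion⇒¬≺ inv (same≺ same)) , tie l◁l'
    where
    tie : ∀ {l l'} → l ◁ l' → point l ≡ point l' → colour l ≡ true × colour l' ≡ false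
    tie (inj₁ a<a) refl = ⊥-elim (<-irrefl refl a<a)
    tie (inj₂ (_ , inj₁ b<b)) refl = ⊥-elim (<-irrefl refl b<b)
    tie (inj₂ (_ , inj₂ (_ , t , f))) refl = t , f

  MergePairs⇒Admissible : ∀ {W} → AllPairs MergePair W → Admissible W
  MergePairs⇒Admissible ps = admissible (linked ps) (MergePairs⇒FarIndependent ps) (adjacent ps)
    where
    linked : ∀ {W} → AllPairs MergePair W → Linked _⊑_ (points W)
    linked [] = []
    linked (_ ∷ []) = [-]
    linked (((l◁l' , _) ∷ _) ∷ rest) = ◁⇒⊑ l◁l' ∷ linked rest
    adjacent : ∀ {W} → AllPairs MergePair W → Linked AdjacentCompatible W
    adjacent [] = []
    adjacent (_ ∷ []) = [-]
    adjacent ((p ∷ _) ∷ rest) = MergePair⇒AdjacentCompatible p ∷ adjacent rest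

  merge-Admissible : ∀ xs ys → AllPairs _≺_ xs → AllPairs _≺_ ys → Admissible (merge xs ys)
  merge-Admissible xs ys xs↑ ys↑ = MergePairs⇒Admissible (merge-MergePair xs ys xs↑ ys↑)

  Admissible-tail : ∀ {l W} → Admissible (l ∷ W) → Admissible W
  Admissible-tail {W = []} _ = admissible [] tt []
  Admissible-tail {W = _ ∷ _} (admissible (_ ∷ s) (_ , f) (_ ∷ a)) = admissible s f a

  Admissible⇒⊑-after : ∀ {l W} → Admissible (l ∷ W) → All (λ z → point l ⊑ point z) W
  Admissible⇒⊑-after adm with Linked⇒AllPairs ⊑-trans (Admissible.sorted adm)
  ... | l⊑W ∷ _ = AllP.map⁻ l⊑W

  Admissible⇒SameColour≺ : ∀ {W} → Admissible W → AllPairs SameColour≺ W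
  Admissible⇒SameColour≺ {[]} _ = []
  Admissible⇒SameColour≺ {l ∷ []} _ = [] ∷ []
  Admissible⇒SameColour≺ {l ∷ l' ∷ W} adm@(admissible (l⊑l' ∷ _) (far , _) (adj ∷ _)) =
    (adjacent l⊑l' adj ∷ zip (All.tail (Admissible⇒⊑-after adm)) (AllP.map⁻ far))
    ∷ Admissible⇒SameColour≺ (Admissible-tail adm)
    where
    adjacent : ∀ {l l'} → point l ⊑ point l' → AdjacentCompatible l l' → SameColour≺ l l'
    adjacent l⊑l' (inv⇒≢ , tie) same = ⊑∧¬Inversion⇒≺ l⊑l' (λ inv → inv⇒≢ inv same)
      (λ eq → different-colours (tie eq) same)
      where
      different-colours : ∀ {c c'} → c ≡ true × c' ≡ false → c ≢ c'
      different-colours (refl , refl) ()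
    zip : ∀ {zs} → All (λ z → point l ⊑ point z) zs → All (λ z → Independent (point l) (point z)) zs →
      All (SameColour≺ l) zs
    zip [] [] = []
    zip (l⊑z ∷ l⊑zs) ((¬inv , ≢) ∷ inds) = (λ _ → ⊑∧¬Inversion⇒≺ l⊑z ¬inv ≢) ∷ zip l⊑zs inds

  select-increasing : ∀ c {W} → AllPairs SameColour≺ W → AllPairs _≺_ (select c W)
  select-increasing c {[]} [] = []
  select-increasing true  {(p , true)  ∷ W} (a ∷ as) =
    All-map (λ f → f refl) (All-select true W a) ∷ select-increasing true as
  select-increasing true  {(p , false) ∷ W} (a ∷ as) = select-increasing true as
  select-increasing false {(p , true)  ∷ W} (a ∷ as) = select-increasing false as
  select-increasing false {(p , false) ∷ W} (a ∷ as) =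
    All-map (λ f → f refl) (All-select false W a) ∷ select-increasing false as

  ⊑∧tie⇒◁ : ∀ {l l'} → point l ⊑ point l' →
    (point l ≡ point l' → colour l ≡ true × colour l' ≡ false) → l ◁ l'
  ⊑∧tie⇒◁ (inj₁ a<c) _ = inj₁ a<c
  ⊑∧tie⇒◁ (inj₂ (refl , d≤b)) tie with m≤n⇒m<n∨m≡n d≤b
  ... | inj₁ d<b = inj₂ (refl , inj₁ d<b)
  ... | inj₂ refl = inj₂ (refl , inj₂ (refl , tie refl))

  Admissible⇒◁ : ∀ {W} → Admissible W → AllPairs _◁_ W
  Admissible⇒◁ {[]} _ = []
  Admissible⇒◁ {l ∷ []} _ = [] ∷ []
  Admissible⇒◁ {l ∷ l' ∷ W} adm@(admissible (l⊑l' ∷ _) (far , _) ((_ , tie) ∷ _)) =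
    (⊑∧tie⇒◁ l⊑l' tie ∷ zip (All.tail (Admissible⇒⊑-after adm)) (AllP.map⁻ far))
    ∷ Admissible⇒◁ (Admissible-tail adm)
    where
    zip : ∀ {zs} → All (λ z → point l ⊑ point z) zs → All (λ z → Independent (point l) (point z)) zs →
      All (l ◁_) zs
    zip [] [] = []
    zip (l⊑z ∷ l⊑zs) ((_ , ≢) ∷ inds) = ⊑∧tie⇒◁ l⊑z (λ eq → ⊥-elim (≢ eq)) ∷ zip l⊑zs inds

  ⊏⇒⋣ : ∀ {u v} → u ⊏ v → ¬ v ⊑ u
  ⊏⇒⋣ (inj₁ a<c) (inj₁ c<a) = <-asym a<c c<a
  ⊏⇒⋣ (inj₁ a<c) (inj₂ (refl , _)) = <-irrefl refl a<c
  ⊏⇒⋣ (inj₂ (refl , _)) (inj₁ a<a) = <-irrefl refl a<a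
  ⊏⇒⋣ (inj₂ (refl , d<b)) (inj₂ (_ , b≤d)) = <-irrefl refl (<-≤-trans d<b b≤d)

  merge-select : ∀ {V} → AllPairs _◁_ V → merge (select true V) (select false V) ≡ V
  merge-select {[]} [] = refl
  merge-select {(p , true) ∷ V} (p◁V ∷ V◁) =
    trans (insert-true p (select true V) (select false V) (All-map ◁⇒⊑ (All-select false V p◁V)))
          (cong ((p , true) ∷_) (merge-select V◁))
    where
    insert-true : ∀ p xs ys → All (p ⊑_) ys → mergeInsert p (merge xs) ys ≡ (p , true) ∷ merge xs ys
    insert-true p xs [] _ = refl
    insert-true p xs (y ∷ ys) (p⊑y ∷ _) with p ⊑? y
    ... | yes _ = refl
    ... | no p⋢y = ⊥-elim (p⋢y p⊑y)
  merge-select {(p , false) ∷ V} (p◁V ∷ V◁) =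
    trans (insert-false (select true V) p (select false V)
            (All-map (λ p◁x → ⊏⇒⋣ (false◁true⇒⊏ p◁x)) (All-select true V p◁V)))
          (cong ((p , false) ∷_) (merge-select V◁))
    where
    insert-false : ∀ xs p ys → All (λ x → ¬ x ⊑ p) xs → merge xs (p ∷ ys) ≡ (p , false) ∷ merge xs ys
    insert-false [] p ys _ = refl
    insert-false (x ∷ xs) p ys (x⋢p ∷ _) with x ⊑? p
    ... | yes x⊑p = ⊥-elim (x⋢p x⊑p)
    ... | no _ = refl
    false◁true⇒⊏ : ∀ {u v} → (u , false) ◁ (v , true) → u ⊏ v
    false◁true⇒⊏ (inj₁ a<c) = inj₁ a<c
    false◁true⇒⊏ (inj₂ (a≡c , inj₁ d<b)) = inj₂ (a≡c , d<b)

  -- Runs of inversions and recolouring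

  _↝_ : Letter → Letter → Set
  l ↝ l' = Inversion (point l) (point l')

  Run : Set
  Run = Letter × Word

  letters : Run → Word
  letters (x , s) = x ∷ s

  concatRuns : List Run → Word
  concatRuns [] = []
  concatRuns ((x , s) ∷ rs) = x ∷ (s ++ concatRuns rs)

  extendRun : Letter → List Run → List Run
  extendRun x [] = (x , []) ∷ []
  extendRun x ((y , s) ∷ rs) with Inversion? (point x) (point y)
  ... | yes _ = (x , y ∷ s) ∷ rs
  ... | no _ = (x , []) ∷ (y , s) ∷ rs

  runs : Word → List Run
  runs [] = []
  runs (x ∷ W) = extendRun x (runs W)

  lastOf : {A : Set} → A → List A → A
  lastOf x [] = x
  lastOf x (y ∷ s) = lastOf y s

  IsRun : Run → Set
  IsRun (x , s) = Linked _↝_ (x ∷ s)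

  MaximalRuns : List Run → Set
  MaximalRuns [] = ⊤
  MaximalRuns (r ∷ []) = IsRun r
  MaximalRuns ((x , s) ∷ (y , t) ∷ rs) = IsRun (x , s) × ¬ lastOf x s ↝ y × MaximalRuns ((y , t) ∷ rs)

  MaximalRuns-head : ∀ r rs → MaximalRuns (r ∷ rs) → IsRun r
  MaximalRuns-head r [] m = m
  MaximalRuns-head r (_ ∷ _) (m , _) = m

  MaximalRuns-tail : ∀ r rs → MaximalRuns (r ∷ rs) → MaximalRuns rs
  MaximalRuns-tail r [] _ = tt
  MaximalRuns-tail r (_ ∷ _) (_ , _ , m) = m

  concatRuns-extendRun : ∀ x rs → concatRuns (extendRun x rs) ≡ x ∷ concatRuns rs
  concatRuns-extendRun x [] = refl
  concatRuns-extendRun x ((y , s) ∷ rs) with Inversion? (point x) (point y)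
  ... | yes _ = refl
  ... | no _ = refl

  concatRuns-runs : ∀ W → concatRuns (runs W) ≡ W
  concatRuns-runs [] = refl
  concatRuns-runs (x ∷ W) = trans (concatRuns-extendRun x (runs W)) (cong (x ∷_) (concatRuns-runs W))

  extendRun-maximal : ∀ x rs → MaximalRuns rs → MaximalRuns (extendRun x rs)
  extendRun-maximal x [] _ = [-]
  extendRun-maximal x ((y , s) ∷ rs) m with Inversion? (point x) (point y)
  extendRun-maximal x ((y , s) ∷ []) m | yes x↝y = x↝y ∷ m
  extendRun-maximal x ((y , s) ∷ _ ∷ _) (m , m′) | yes x↝y = (x↝y ∷ m) , m′
  ... | no ¬x↝y = [-] , ¬x↝y , m

  runs-maximal : ∀ W → MaximalRuns (runs W)
  runs-maximal [] = tt
  runs-maximal (x ∷ W) = extendRun-maximal x (runs W) (runs-maximal W)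

  AtBoundary : Letter → List Run → Set
  AtBoundary l [] = ⊤
  AtBoundary l ((y , _) ∷ _) = ¬ l ↝ y

  mutual
    runs-concatRuns : ∀ rs → MaximalRuns rs → runs (concatRuns rs) ≡ rs
    runs-concatRuns [] _ = refl
    runs-concatRuns ((x , s) ∷ []) m = runs-concatRun x s [] m tt tt
    runs-concatRuns ((x , s) ∷ (y , t) ∷ rs) (m , b , m′) = runs-concatRun x s ((y , t) ∷ rs) m b m′

    runs-concatRun : ∀ x s rs → IsRun (x , s) → AtBoundary (lastOf x s) rs → MaximalRuns rs →
      runs (x ∷ (s ++ concatRuns rs)) ≡ (x , s) ∷ rs
    runs-concatRun x [] [] _ _ _ = refl
    runs-concatRun x [] ((y , t) ∷ rs) _ ¬x↝y m rewrite runs-concatRuns ((y , t) ∷ rs) m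
      with Inversion? (point x) (point y)
    ... | yes x↝y = ⊥-elim (¬x↝y x↝y)
    ... | no _ = refl
    runs-concatRun x (y ∷ s) rs (x↝y ∷ run) b m rewrite runs-concatRun y s rs run b m
      with Inversion? (point x) (point y)
    ... | yes _ = refl
    ... | no ¬x↝y = ⊥-elim (¬x↝y x↝y)

  evenᵇ : ℕ → Bool
  evenᵇ zero = true
  evenᵇ (suc zero) = false
  evenᵇ (suc (suc n)) = evenᵇ n

  toggle : Letter → Letter
  toggle (p , c) = p , not c

  recolourRun : Run → Run
  recolourRun (x , s) = if evenᵇ (length (x ∷ s)) then (toggle x , map toggle s) else (x , s)

  recolour : Word → Word
  recolour W = concatRuns (map recolourRun (runs W))

  toggle-involutive : ∀ l → toggle (toggle l) ≡ l
  toggle-involutive (p , c) = cong (p ,_) (not-involutive c)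

  map-toggle-involutive : ∀ s → map toggle (map toggle s) ≡ s
  map-toggle-involutive [] = refl
  map-toggle-involutive (l ∷ s) = cong₂ _∷_ (toggle-involutive l) (map-toggle-involutive s)

  recolourRun-involutive : ∀ r → recolourRun (recolourRun r) ≡ r
  recolourRun-involutive (x , s) with evenᵇ (suc (length s)) in even
  ... | true rewrite length-map toggle s | even = cong₂ _,_ (toggle-involutive x) (map-toggle-involutive s)
  ... | false rewrite even = refl

  Linked-toggle : ∀ {s} → Linked _↝_ s → Linked _↝_ (map toggle s)
  Linked-toggle [] = []
  Linked-toggle [-] = [-]
  Linked-toggle (x↝y ∷ run) = x↝y ∷ Linked-toggle run

  lastOf-map : {A B : Set} (f : A → B) → ∀ x s → lastOf (f x) (map f s) ≡ f (lastOf x s)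
  lastOf-map f x [] = refl
  lastOf-map f x (y ∷ s) = lastOf-map f y s

  lastPoint-recolourRun : ∀ x s → point (uncurry lastOf (recolourRun (x , s))) ≡ point (lastOf x s)
  lastPoint-recolourRun x s with evenᵇ (suc (length s))
  ... | true = cong point (lastOf-map toggle x s)
  ... | false = refl

  headPoint-recolourRun : ∀ r → point (proj₁ (recolourRun r)) ≡ point (proj₁ r)
  headPoint-recolourRun (x , s) with evenᵇ (suc (length s))
  ... | true = refl
  ... | false = refl

  recolourRun-IsRun : ∀ r → IsRun r → IsRun (recolourRun r)
  recolourRun-IsRun (x , s) run with evenᵇ (suc (length s))
  ... | true = Linked-toggle run
  ... | false = run

  ¬↝-recolourRun : ∀ x s y t → ¬ lastOf x s ↝ y →
    ¬ uncurry lastOf (recolourRun (x , s)) ↝ proj₁ (recolourRun (y , t))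
  ¬↝-recolourRun x s y t ¬↝ =
    ¬↝ ∘ subst₂ Inversion (lastPoint-recolourRun x s) (headPoint-recolourRun (y , t))

  recolourRuns-maximal : ∀ rs → MaximalRuns rs → MaximalRuns (map recolourRun rs)
  recolourRuns-maximal [] _ = tt
  recolourRuns-maximal (r ∷ []) m = recolourRun-IsRun r m
  recolourRuns-maximal ((x , s) ∷ (y , t) ∷ rs) (m , b , m′) =
    recolourRun-IsRun (x , s) m , ¬↝-recolourRun x s y t b , recolourRuns-maximal ((y , t) ∷ rs) m′

  map-recolourRun-involutive : ∀ rs → map recolourRun (map recolourRun rs) ≡ rs
  map-recolourRun-involutive [] = refl
  map-recolourRun-involutive (r ∷ rs) = cong₂ _∷_ (recolourRun-involutive r) (map-recolourRun-involutive rs)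

  recolour-involutive : ∀ W → recolour (recolour W) ≡ W
  recolour-involutive W = begin
    concatRuns (map recolourRun (runs (concatRuns (map recolourRun (runs W)))))
      ≡⟨ cong (concatRuns ∘ map recolourRun)
              (runs-concatRuns _ (recolourRuns-maximal (runs W) (runs-maximal W))) ⟩
    concatRuns (map recolourRun (map recolourRun (runs W)))
      ≡⟨ cong concatRuns (map-recolourRun-involutive (runs W)) ⟩
    concatRuns (runs W)
      ≡⟨ concatRuns-runs W ⟩
    W ∎
    where open ≡-Reasoning

  points-toggle : ∀ s → points (map toggle s) ≡ points s
  points-toggle [] = refl
  points-toggle (l ∷ s) = cong (point l ∷_) (points-toggle s)

  points-recolourRun : ∀ r W → points (letters (recolourRun r) ++ W) ≡ points (letters r ++ W)
  points-recolourRun (x , s) W with evenᵇ (suc (length s))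
  ... | true = cong (point x ∷_) (begin
    points (map toggle s ++ W)        ≡⟨ map-++ point (map toggle s) W ⟩
    points (map toggle s) ++ points W ≡⟨ cong (_++ points W) (points-toggle s) ⟩
    points s ++ points W              ≡⟨ map-++ point s W ⟨
    points (s ++ W)                   ∎)
    where open ≡-Reasoning
  ... | false = refl

  points-recolourRuns : ∀ rs → points (concatRuns (map recolourRun rs)) ≡ points (concatRuns rs)
  points-recolourRuns [] = refl
  points-recolourRuns ((x , s) ∷ rs) = begin
    points (letters (recolourRun (x , s)) ++ concatRuns (map recolourRun rs))
      ≡⟨ points-recolourRun (x , s) _ ⟩
    point x ∷ points (s ++ concatRuns (map recolourRun rs))
      ≡⟨ cong (point x ∷_) (map-++ point s _) ⟩
    point x ∷ points s ++ points (concatRuns (map recolourRun rs))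
      ≡⟨ cong (λ ps → point x ∷ points s ++ ps) (points-recolourRuns rs) ⟩
    point x ∷ points s ++ points (concatRuns rs)
      ≡⟨ cong (point x ∷_) (map-++ point s _) ⟨
    points (letters (x , s) ++ concatRuns rs) ∎
    where open ≡-Reasoning

  points-recolour : ∀ W → points (recolour W) ≡ points W
  points-recolour W = trans (points-recolourRuns (runs W)) (cong points (concatRuns-runs W))

  ConnectedTo : {A : Set} → (A → A → Set) → A → List A → Set
  ConnectedTo R x [] = ⊤
  ConnectedTo R x (y ∷ _) = R x y

  Linked-split : {A : Set} {R : A → A → Set} → ∀ x t r → Linked R (x ∷ t ++ r) →
    Linked R (x ∷ t) × ConnectedTo R (lastOf x t) r × Linked R r
  Linked-split x [] [] _ = [-] , tt , []
  Linked-split x [] (y ∷ r) (x~y ∷ rest) = [-] , x~y , rest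
  Linked-split x (z ∷ t) r (x~z ∷ rest) =
    let (left , bridge , right) = Linked-split z t r rest in x~z ∷ left , bridge , right

  Linked-join : {A : Set} {R : A → A → Set} → ∀ x t r →
    Linked R (x ∷ t) → ConnectedTo R (lastOf x t) r → Linked R r → Linked R (x ∷ t ++ r)
  Linked-join x [] [] _ _ _ = [-]
  Linked-join x [] (y ∷ r) _ x~y rest = x~y ∷ rest
  Linked-join x (z ∷ t) r (x~z ∷ left) bridge right = x~z ∷ Linked-join z t r left bridge right

  FarIndependent-drop : ∀ x t r → FarIndependent (points (x ∷ t ++ r)) → FarIndependent (points r)
  FarIndependent-drop x [] [] _ = tt
  FarIndependent-drop x [] (y ∷ r) (_ , far) = far
  FarIndependent-drop x (z ∷ t) r (_ , far) = FarIndependent-drop z t r far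

  FarIndependent-beforeLast : ∀ x t y z r → FarIndependent (points (x ∷ t ++ y ∷ z ∷ r)) →
    Independent (point (lastOf x t)) (point z)
  FarIndependent-beforeLast x [] y z r (ind ∷ _ , _) = ind
  FarIndependent-beforeLast x (w ∷ t) y z r (_ , far) = FarIndependent-beforeLast w t y z r far

  -- Two runs can only meet in equal points when both are single letters, since a neighbour
  -- inverted with one of the equal points would be inverted with the other, non-adjacent one.
  equalBoundary⇒left-single : ∀ x t y r → IsRun (x , t) → FarIndependent (points (x ∷ t ++ y ∷ r)) →
    point (lastOf x t) ≡ point y → t ≡ []
  equalBoundary⇒left-single x [] y r _ _ _ = refl
  equalBoundary⇒left-single x (z ∷ []) y r (x↝z ∷ _) ((ind ∷ _) , _) z≡y =
    ⊥-elim (proj₁ ind (subst (Inversion (point x)) z≡y x↝z))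
  equalBoundary⇒left-single x (z ∷ w ∷ t) y r (_ ∷ run) (_ , far) last≡y
    with equalBoundary⇒left-single z (w ∷ t) y r run far last≡y
  ... | ()

  equalBoundary⇒right-single : ∀ x t y u r → point (lastOf x t) ≡ point y → IsRun (y , u) →
    FarIndependent (points (x ∷ t ++ y ∷ u ++ r)) → u ≡ []
  equalBoundary⇒right-single x t y [] r _ _ _ = refl
  equalBoundary⇒right-single x t y (z ∷ u) r last≡y (y↝z ∷ _) far =
    ⊥-elim (proj₁ (FarIndependent-beforeLast x t y z (u ++ r) far)
                  (subst (λ p → Inversion p (point z)) (sym last≡y) y↝z))

  Linked-toggle-adjacent : ∀ {s} → Linked _↝_ s → Linked AdjacentCompatible s →
    Linked AdjacentCompatible (map toggle s)
  Linked-toggle-adjacent [] [] = []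
  Linked-toggle-adjacent [-] [-] = [-]
  Linked-toggle-adjacent {l ∷ l' ∷ _} (l↝l' ∷ run) ((≢ , _) ∷ adj) =
    ((λ _ → ≢ l↝l' ∘ not-injective) ,
     (λ eq → ⊥-elim (Inversion-irrefl (subst (λ p → Inversion p (point l')) eq l↝l'))))
    ∷ Linked-toggle-adjacent run adj

  recolourRun-adjacent : ∀ x t → IsRun (x , t) → Linked AdjacentCompatible (x ∷ t) →
    Linked AdjacentCompatible (letters (recolourRun (x , t)))
  recolourRun-adjacent x t run adj with evenᵇ (suc (length t))
  ... | true = Linked-toggle-adjacent run adj
  ... | false = adj

  boundary-adjacent : ∀ x t y u → ¬ lastOf x t ↝ y → AdjacentCompatible (lastOf x t) y →
    (point (lastOf x t) ≡ point y → t ≡ [] × u ≡ []) →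
    AdjacentCompatible (uncurry lastOf (recolourRun (x , t))) (proj₁ (recolourRun (y , u)))
  boundary-adjacent x t y u ¬↝ (_ , tie) singles = (λ inv → ⊥-elim (¬↝-recolourRun x t y u ¬↝ inv)) , tie′
    where
    tie′ : point (uncurry lastOf (recolourRun (x , t))) ≡ point (proj₁ (recolourRun (y , u))) →
      colour (uncurry lastOf (recolourRun (x , t))) ≡ true × colour (proj₁ (recolourRun (y , u))) ≡ false
    tie′ eq with singles (trans (sym (lastPoint-recolourRun x t)) (trans eq (headPoint-recolourRun (y , u))))
    ... | refl , refl = tie eq

  recolourRuns-adjacent : ∀ rs → MaximalRuns rs → FarIndependent (points (concatRuns rs)) →
    Linked AdjacentCompatible (concatRuns rs) → Linked AdjacentCompatible (concatRuns (map recolourRun rs))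
  recolourRuns-adjacent [] _ _ _ = []
  recolourRuns-adjacent ((x , t) ∷ rs) m far adj =
    let (left , bridge , right) = Linked-split x t (concatRuns rs) adj in
    Linked-join (proj₁ (recolourRun (x , t))) (proj₂ (recolourRun (x , t))) _
      (recolourRun-adjacent x t (MaximalRuns-head (x , t) rs m) left)
      (bridge′ rs m far bridge)
      (recolourRuns-adjacent rs (MaximalRuns-tail (x , t) rs m) (FarIndependent-drop x t _ far) right)
    where
    bridge′ : ∀ rs → MaximalRuns ((x , t) ∷ rs) → FarIndependent (points (concatRuns ((x , t) ∷ rs))) →
      ConnectedTo AdjacentCompatible (lastOf x t) (concatRuns rs) →
      ConnectedTo AdjacentCompatible (uncurry lastOf (recolourRun (x , t))) (concatRuns (map recolourRun rs))
    bridge′ [] _ _ _ = tt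
    bridge′ ((y , u) ∷ rs) (run , ¬↝ , m′) far adj = boundary-adjacent x t y u ¬↝ adj
      (λ eq → equalBoundary⇒left-single x t y _ run far eq ,
              equalBoundary⇒right-single x t y u _ eq (MaximalRuns-head (y , u) rs m′) far)

  recolour-Admissible : ∀ {W} → Admissible W → Admissible (recolour W)
  recolour-Admissible {W} (admissible sorted far adj) = admissible
    (subst (Linked _⊑_) (sym (points-recolour W)) sorted)
    (subst FarIndependent (sym (points-recolour W)) far)
    (recolourRuns-adjacent (runs W) (runs-maximal W)
      (subst (FarIndependent ∘ points) (sym (concatRuns-runs W)) far)
      (subst (Linked AdjacentCompatible) (sym (concatRuns-runs W)) adj))

  Alternating : Word → Set
  Alternating = Linked (λ l l' → colour l ≢ colour l')

  run⇒Alternating : ∀ {s} → Linked _↝_ s → Linked AdjacentCompatible s → Alternating s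
  run⇒Alternating [] [] = []
  run⇒Alternating [-] [-] = [-]
  run⇒Alternating (l↝l' ∷ run) ((≢ , _) ∷ adj) = ≢ l↝l' ∷ run⇒Alternating run adj

  select-++ : ∀ c xs ys → select c (xs ++ ys) ≡ select c xs ++ select c ys
  select-++ c [] ys = refl
  select-++ true  ((p , true)  ∷ xs) ys = cong (p ∷_) (select-++ true xs ys)
  select-++ true  ((p , false) ∷ xs) ys = select-++ true xs ys
  select-++ false ((p , true)  ∷ xs) ys = select-++ false xs ys
  select-++ false ((p , false) ∷ xs) ys = cong (p ∷_) (select-++ false xs ys)

  select-toggle : ∀ c xs → select c (map toggle xs) ≡ select (not c) xs
  select-toggle c [] = refl
  select-toggle true  ((p , true)  ∷ xs) = select-toggle true xs
  select-toggle true  ((p , false) ∷ xs) = cong (p ∷_) (select-toggle true xs)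
  select-toggle false ((p , true)  ∷ xs) = cong (p ∷_) (select-toggle false xs)
  select-toggle false ((p , false) ∷ xs) = select-toggle false xs

  colourCount : Bool → Word → ℕ
  colourCount c W = length (select c W)

  colourCount-++ : ∀ c xs ys → colourCount c (xs ++ ys) ≡ colourCount c xs + colourCount c ys
  colourCount-++ c xs ys = trans (cong length (select-++ c xs ys)) (length-++ (select c xs))

  Alternating-even-balanced : ∀ xs → Alternating xs → evenᵇ (length xs) ≡ true →
    colourCount true xs ≡ colourCount false xs
  Alternating-even-balanced [] _ _ = refl
  Alternating-even-balanced ((p , true) ∷ (q , false) ∷ r) (_ ∷ alt) even =
    cong suc (Alternating-even-balanced r (Linked-tail alt) even)
  Alternating-even-balanced ((p , false) ∷ (q , true) ∷ r) (_ ∷ alt) even =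
    cong suc (Alternating-even-balanced r (Linked-tail alt) even)
  Alternating-even-balanced ((p , true) ∷ (q , true) ∷ r) (≢ ∷ _) _ = ⊥-elim (≢ refl)
  Alternating-even-balanced ((p , false) ∷ (q , false) ∷ r) (≢ ∷ _) _ = ⊥-elim (≢ refl)

  recolourRun-count : ∀ c x t → IsRun (x , t) → Linked AdjacentCompatible (x ∷ t) →
    colourCount c (letters (recolourRun (x , t))) ≡ colourCount c (x ∷ t)
  recolourRun-count c x t run adj with evenᵇ (suc (length t)) in even
  ... | false = refl
  ... | true = trans (cong length (select-toggle c (x ∷ t))) (swap c)
    where
    balanced = Alternating-even-balanced (x ∷ t) (run⇒Alternating run adj) even
    swap : ∀ c → colourCount (not c) (x ∷ t) ≡ colourCount c (x ∷ t)
    swap true = sym balanced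
    swap false = balanced

  recolourRuns-count : ∀ c rs → MaximalRuns rs → Linked AdjacentCompatible (concatRuns rs) →
    colourCount c (concatRuns (map recolourRun rs)) ≡ colourCount c (concatRuns rs)
  recolourRuns-count c [] _ _ = refl
  recolourRuns-count c ((x , t) ∷ rs) m adj = begin
    colourCount c (letters (recolourRun (x , t)) ++ concatRuns (map recolourRun rs))
      ≡⟨ colourCount-++ c (letters (recolourRun (x , t))) _ ⟩
    colourCount c (letters (recolourRun (x , t))) + colourCount c (concatRuns (map recolourRun rs))
      ≡⟨ cong₂ _+_ (recolourRun-count c x t (MaximalRuns-head (x , t) rs m) left)
                   (recolourRuns-count c rs (MaximalRuns-tail (x , t) rs m) right) ⟩
    colourCount c (x ∷ t) + colourCount c (concatRuns rs)
      ≡⟨ colourCount-++ c (x ∷ t) (concatRuns rs) ⟨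
    colourCount c (x ∷ t ++ concatRuns rs) ∎
    where
    open ≡-Reasoning
    split = Linked-split x t (concatRuns rs) adj
    left = proj₁ split
    right = proj₂ (proj₂ split)

  recolour-count : ∀ c {W} → Admissible W → colourCount c (recolour W) ≡ colourCount c W
  recolour-count c {W} adm =
    trans (recolourRuns-count c (runs W) (runs-maximal W)
            (subst (Linked AdjacentCompatible) (sym (concatRuns-runs W)) (Admissible.adjacent adm)))
          (cong (colourCount c) (concatRuns-runs W))

  -- Inversions between the colour classes

  crossWeight : Bool → Letter → Letter → ℕ
  crossWeight true  (p , true)  (p' , false) = dinvPair p p'
  crossWeight false (p , false) (p' , true)  = dinvPair p p'
  crossWeight _ _ _ = 0

  adjacentCross : Bool → Word → ℕ
  adjacentCross c (l ∷ l' ∷ W) = crossWeight c l l' + adjacentCross c (l' ∷ W)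
  adjacentCross c _ = 0

  bridgeWeight : Bool → Letter → Word → ℕ
  bridgeWeight c l [] = 0
  bridgeWeight c l (y ∷ _) = crossWeight c l y

  adjacentCross-++ : ∀ c x t r →
    adjacentCross c (x ∷ t ++ r) ≡ adjacentCross c (x ∷ t) + bridgeWeight c (lastOf x t) r + adjacentCross c r
  adjacentCross-++ c x [] [] = refl
  adjacentCross-++ c x [] (y ∷ r) = refl
  adjacentCross-++ c x (z ∷ t) r rewrite adjacentCross-++ c z t r =
    trans (sym (+-assoc (crossWeight c x z) _ _))
          (cong (_+ adjacentCross c r) (sym (+-assoc (crossWeight c x z) _ _)))

  crossWeight-toggle : ∀ l l' → crossWeight true (toggle l) (toggle l') ≡ crossWeight false l l'
  crossWeight-toggle (p , true)  (p' , true)  = refl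
  crossWeight-toggle (p , true)  (p' , false) = refl
  crossWeight-toggle (p , false) (p' , true)  = refl
  crossWeight-toggle (p , false) (p' , false) = refl

  adjacentCross-toggle : ∀ xs → adjacentCross true (map toggle xs) ≡ adjacentCross false xs
  adjacentCross-toggle [] = refl
  adjacentCross-toggle (a ∷ []) = refl
  adjacentCross-toggle (a ∷ b ∷ r) = cong₂ _+_ (crossWeight-toggle a b) (adjacentCross-toggle (b ∷ r))

  crossWeight-¬↝ : ∀ c l l' → ¬ l ↝ l' → crossWeight c l l' ≡ 0
  crossWeight-¬↝ true  (p , true)  (p' , false) ¬↝ = dinvPair-¬inversion p p' ¬↝
  crossWeight-¬↝ false (p , false) (p' , true)  ¬↝ = dinvPair-¬inversion p p' ¬↝
  crossWeight-¬↝ true  (_ , true)  (_ , true)  _ = refl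
  crossWeight-¬↝ true  (_ , false) _           _ = refl
  crossWeight-¬↝ false (_ , true)  _           _ = refl
  crossWeight-¬↝ false (_ , false) (_ , false) _ = refl

  -- Along an alternating run each inverted pair is counted by exactly one of the two colour orders;
  -- an odd run starts and ends with the same colour, so both orders count the same number.
  Alternating-odd-balanced : ∀ xs → Linked _↝_ xs → Alternating xs → evenᵇ (length xs) ≡ false →
    adjacentCross true xs ≡ adjacentCross false xs
  Alternating-odd-balanced (a ∷ []) _ _ _ = refl
  Alternating-odd-balanced (a ∷ b ∷ c ∷ r) (a↝b ∷ b↝c ∷ run) (a≢b ∷ b≢c ∷ alt) odd =
    trans (sym (+-assoc (crossWeight true a b) _ _))
      (trans (cong₂ _+_ (pair a b c a↝b b↝c a≢b b≢c) (Alternating-odd-balanced (c ∷ r) run alt odd))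
             (+-assoc (crossWeight false a b) _ _))
    where
    pair : ∀ a b c → a ↝ b → b ↝ c → colour a ≢ colour b → colour b ≢ colour c →
      crossWeight true a b + crossWeight true b c ≡ crossWeight false a b + crossWeight false b c
    pair (p , true) (p' , false) (p'' , true) a↝b b↝c _ _
      rewrite dinvPair-inversion p p' a↝b | dinvPair-inversion p' p'' b↝c = refl
    pair (p , false) (p' , true) (p'' , false) a↝b b↝c _ _
      rewrite dinvPair-inversion p p' a↝b | dinvPair-inversion p' p'' b↝c = refl
    pair (_ , true)  (_ , true)  _ _ _ ≢ _ = ⊥-elim (≢ refl)
    pair (_ , false) (_ , false) _ _ _ ≢ _ = ⊥-elim (≢ refl)
    pair (_ , true)  (_ , false) (_ , false) _ _ _ ≢ = ⊥-elim (≢ refl)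
    pair (_ , false) (_ , true)  (_ , true)  _ _ _ ≢ = ⊥-elim (≢ refl)

  recolourRun-cross : ∀ x t → IsRun (x , t) → Linked AdjacentCompatible (x ∷ t) →
    adjacentCross true (letters (recolourRun (x , t))) ≡ adjacentCross false (x ∷ t)
  recolourRun-cross x t run adj with evenᵇ (suc (length t)) in even
  ... | true = adjacentCross-toggle (x ∷ t)
  ... | false = Alternating-odd-balanced (x ∷ t) run (run⇒Alternating run adj) even

  recolourRuns-cross : ∀ rs → MaximalRuns rs → Linked AdjacentCompatible (concatRuns rs) →
    adjacentCross true (concatRuns (map recolourRun rs)) ≡ adjacentCross false (concatRuns rs)
  recolourRuns-cross [] _ _ = refl
  recolourRuns-cross ((x , t) ∷ rs) m adj = begin
    adjacentCross true (x′ ∷ t′ ++ concatRuns (map recolourRun rs))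
      ≡⟨ adjacentCross-++ true x′ t′ _ ⟩
    adjacentCross true (x′ ∷ t′) + bridgeWeight true (lastOf x′ t′) (concatRuns (map recolourRun rs))
      + adjacentCross true (concatRuns (map recolourRun rs))
      ≡⟨ cong₂ _+_ (cong₂ _+_ (recolourRun-cross x t (MaximalRuns-head (x , t) rs m) left)
                              (trans (bridge-zero true rs m) (sym (bridge-zero′ rs m))))
                   (recolourRuns-cross rs (MaximalRuns-tail (x , t) rs m) right) ⟩
    adjacentCross false (x ∷ t) + bridgeWeight false (lastOf x t) (concatRuns rs)
      + adjacentCross false (concatRuns rs)
      ≡⟨ adjacentCross-++ false x t _ ⟨
    adjacentCross false (x ∷ t ++ concatRuns rs) ∎
    where
    open ≡-Reasoning
    x′ = proj₁ (recolourRun (x , t))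
    t′ = proj₂ (recolourRun (x , t))
    split = Linked-split x t (concatRuns rs) adj
    left = proj₁ split
    right = proj₂ (proj₂ split)
    bridge-zero : ∀ c rs → MaximalRuns ((x , t) ∷ rs) →
      bridgeWeight c (lastOf x′ t′) (concatRuns (map recolourRun rs)) ≡ 0
    bridge-zero c [] _ = refl
    bridge-zero c ((y , u) ∷ rs) (_ , ¬↝ , _) =
      crossWeight-¬↝ c (lastOf x′ t′) (proj₁ (recolourRun (y , u))) (¬↝-recolourRun x t y u ¬↝)
    bridge-zero′ : ∀ rs → MaximalRuns ((x , t) ∷ rs) → bridgeWeight false (lastOf x t) (concatRuns rs) ≡ 0
    bridge-zero′ [] _ = refl
    bridge-zero′ ((y , u) ∷ rs) (_ , ¬↝ , _) = crossWeight-¬↝ false (lastOf x t) y ¬↝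

  recolour-cross : ∀ {W} → Admissible W → adjacentCross true (recolour W) ≡ adjacentCross false W
  recolour-cross {W} adm =
    trans (recolourRuns-cross (runs W) (runs-maximal W)
            (subst (Linked AdjacentCompatible) (sym (concatRuns-runs W)) (Admissible.adjacent adm)))
          (cong (adjacentCross false) (concatRuns-runs W))

  dinv-cons-right : ∀ X y Y → dinvSum X (y ∷ Y) ≡ sum (map (λ x → dinvPair x y) X) + dinvSum X Y
  dinv-cons-right [] y Y = refl
  dinv-cons-right (x ∷ X) y Y rewrite dinv-cons-right X y Y =
    +-interchange (dinvPair x y) (sum (map (dinvPair x) Y)) _ (dinvSum X Y)

  sum-map-zero : {A : Set} (f : A → ℕ) → ∀ {xs} → All (λ x → f x ≡ 0) xs → sum (map f xs) ≡ 0
  sum-map-zero f [] = refl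
  sum-map-zero f (fx≡0 ∷ rest) rewrite fx≡0 | sum-map-zero f rest = refl

  dinv-from-independent : ∀ {p} c W → All (Independent p) (points W) → sum (map (dinvPair p) (select c W)) ≡ 0
  dinv-from-independent {p} c W inds =
    sum-map-zero (dinvPair p) (All-map (dinvPair-¬inversion _ _ ∘ proj₁) (All-select c W (AllP.map⁻ inds)))

  dinv-to-later : ∀ {p} c W → All (λ l → p ⊑ point l) W → sum (map (λ x → dinvPair x p) (select c W)) ≡ 0
  dinv-to-later {p} c W p⊑W =
    sum-map-zero (λ x → dinvPair x p) (All-map (λ p⊑x → dinvPair-¬inversion _ _ (⊑⇒¬Inversion-reversed p⊑x))
      (All-select c W p⊑W))

  crossWeight-first : ∀ c p l W → All (Independent p) (points W) →
    sum (map (dinvPair p) (select (not c) (l ∷ W))) ≡ crossWeight c (p , c) l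
  crossWeight-first true p (q , true) W inds = dinv-from-independent false W inds
  crossWeight-first true p (q , false) W inds rewrite dinv-from-independent false W inds = +-identityʳ _
  crossWeight-first false p (q , false) W inds = dinv-from-independent true W inds
  crossWeight-first false p (q , true) W inds rewrite dinv-from-independent true W inds = +-identityʳ _

  -- Far-apart letters are independent and a later letter never forms an inversion with an earlier
  -- one, so only adjacent pairs of letters contribute to dinv between the two colour classes.
  dinv-select : ∀ c W → Admissible W → dinvSum (select c W) (select (not c) W) ≡ adjacentCross c W
  dinv-select c [] _ = refl
  dinv-select true  ((p , true)  ∷ []) _ = refl
  dinv-select true  ((p , false) ∷ []) _ = refl
  dinv-select false ((p , true)  ∷ []) _ = refl
  dinv-select false ((p , false) ∷ []) _ = refl
  dinv-select true ((p , true) ∷ W@(l ∷ W′)) adm =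
    cong₂ _+_ (crossWeight-first true p l W′ (proj₁ (Admissible.far adm)))
              (dinv-select true W (Admissible-tail adm))
  dinv-select false ((p , false) ∷ W@(l ∷ W′)) adm =
    cong₂ _+_ (crossWeight-first false p l W′ (proj₁ (Admissible.far adm)))
              (dinv-select false W (Admissible-tail adm))
  dinv-select true ((p , false) ∷ W@(l ∷ W′)) adm =
    trans (dinv-cons-right (select true W) p (select false W))
      (cong₂ _+_ (dinv-to-later true W (Admissible⇒⊑-after adm)) (dinv-select true W (Admissible-tail adm)))
  dinv-select false ((p , true) ∷ W@(l ∷ W′)) adm =
    trans (dinv-cons-right (select false W) p (select true W))
      (cong₂ _+_ (dinv-to-later false W (Admissible⇒⊑-after adm)) (dinv-select false W (Admissible-tail adm)))

  sum-map-+ : {A : Set} (f g : A → ℕ) → ∀ xs →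
    sum (map (λ x → f x + g x) xs) ≡ sum (map f xs) + sum (map g xs)
  sum-map-+ f g [] = refl
  sum-map-+ f g (x ∷ xs) rewrite sum-map-+ f g xs = +-interchange (f x) (g x) _ _

  dinvSum-++ˡ : ∀ X Y A → dinvSum (X ++ Y) A ≡ dinvSum X A + dinvSum Y A
  dinvSum-++ˡ X Y A = trans (cong sum (map-++ _ X Y)) (sum-++ (map _ X) _)

  dinvSum-++ʳ : ∀ X Y Z → dinvSum X (Y ++ Z) ≡ dinvSum X Y + dinvSum X Z
  dinvSum-++ʳ X Y Z = trans
    (cong sum (map-cong (λ p → trans (cong sum (map-++ (dinvPair p) Y Z)) (sum-++ (map (dinvPair p) Y) _)) X))
    (sum-map-+ (λ p → sum (map (dinvPair p) Y)) (λ p → sum (map (dinvPair p) Z)) X)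

  dinvSum-↭ˡ : ∀ {X X'} A → X ↭ X' → dinvSum X A ≡ dinvSum X' A
  dinvSum-↭ˡ A X↭X' = sum-↭ (↭P.map⁺ _ X↭X')

  -- The exchange of two chains

  select-↭ : ∀ V → select true V ++ select false V ↭ points V
  select-↭ [] = ↭-refl
  select-↭ ((p , true) ∷ V) = prep p (select-↭ V)
  select-↭ ((p , false) ∷ V) = ↭-trans (↭P.shift p (select true V) (select false V)) (prep p (select-↭ V))

  column0Count : List Pt → ℕ
  column0Count X = sum (map (λ p → χ (proj₁ p ≡ᵇ 0)) X)

  headInColumn0 : List Pt → ℕ
  headInColumn0 [] = 0
  headInColumn0 (x ∷ _) = χ (proj₁ x ≡ᵇ 0)

  nonEmpty : List Pt → ℕ
  nonEmpty [] = 0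
  nonEmpty (_ ∷ _) = 1

  column0Count-increasing : ∀ {X} → AllPairs _≺_ X → column0Count X ≡ headInColumn0 X
  column0Count-increasing [] = refl
  column0Count-increasing {x ∷ xs} (x≺xs ∷ _) =
    trans (cong (χ (proj₁ x ≡ᵇ 0) +_) (sum-map-zero _ (All-map later-nonzero x≺xs))) (+-identityʳ _)
    where
    later-nonzero : ∀ {y} → x ≺ y → χ (proj₁ y ≡ᵇ 0) ≡ 0
    later-nonzero {y} x≺y = χ-false (λ t → <⇒≢ (≤-<-trans z≤n (≺⇒< x≺y)) (sym (≡ᵇ⇒≡ (proj₁ y) 0 t)))

  column0Count-++ : ∀ X Y → column0Count (X ++ Y) ≡ column0Count X + column0Count Y
  column0Count-++ X Y = trans (cong sum (map-++ _ X Y)) (sum-++ (map _ X) _)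

  column0Count-↭ : ∀ {X Y} → X ↭ Y → column0Count X ≡ column0Count Y
  column0Count-↭ X↭Y = sum-↭ (↭P.map⁺ _ X↭Y)

  headInColumn0≤nonEmpty : ∀ X → headInColumn0 X ≤ nonEmpty X
  headInColumn0≤nonEmpty [] = z≤n
  headInColumn0≤nonEmpty ((zero , _) ∷ _) = ≤-refl
  headInColumn0≤nonEmpty ((suc _ , _) ∷ _) = z≤n

  nonEmpty-length : ∀ X Y → length X ≡ length Y → nonEmpty X ≡ nonEmpty Y
  nonEmpty-length [] [] _ = refl
  nonEmpty-length (_ ∷ _) (_ ∷ _) _ = refl

  bar⇒headInColumn0 : ∀ X → T (firstOKᵇ bar X) → headInColumn0 X ≡ nonEmpty X
  bar⇒headInColumn0 [] _ = refl
  bar⇒headInColumn0 (x ∷ _) t = χ-true t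

  headInColumn0⇒bar : ∀ X → headInColumn0 X ≡ nonEmpty X → T (firstOKᵇ bar X)
  headInColumn0⇒bar [] _ = tt
  headInColumn0⇒bar ((zero , _) ∷ _) _ = tt

  +-tight : ∀ {a b c d} → a ≤ c → b ≤ d → a + b ≡ c + d → a ≡ c
  +-tight a≤c b≤d eq with m≤n⇒m<n∨m≡n a≤c
  ... | inj₁ a<c = ⊥-elim (<-irrefl eq (+-mono-<-≤ a<c b≤d))
  ... | inj₂ a≡c = a≡c

  hat⇒All-column≥1 : ∀ L → AllPairs _≺_ L → T (firstOKᵇ hat L) → All (λ p → 1 ≤ proj₁ p) L
  hat⇒All-column≥1 [] _ _ = []
  hat⇒All-column≥1 (x ∷ L) (x≺L ∷ _) t = 1≤x ∷ All-map (λ x≺y → ≤-trans 1≤x (<⇒≤ (≺⇒< x≺y))) x≺L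
    where 1≤x = ≤ᵇ⇒≤ 1 (proj₁ x) t

  All-column≥1⇒hat : ∀ L → All (λ p → 1 ≤ proj₁ p) L → T (firstOKᵇ hat L)
  All-column≥1⇒hat [] _ = tt
  All-column≥1⇒hat (x ∷ L) (1≤x ∷ _) = ≤⇒≤ᵇ 1≤x

  exchange : List Pt → List Pt → List Pt × List Pt
  exchange L L' = select true (recolour (merge L L')) , select false (recolour (merge L L'))

  module Exchange {κ L L'} (L-chain : IsChain κ L) (L'-chain : IsChain κ L') where

    L↑ = IsChain.increasing L-chain
    L'↑ = IsChain.increasing L'-chain
    W = merge L L'
    V = recolour W
    Q = proj₁ (exchange L L')
    P = proj₂ (exchange L L')

    W-admissible : Admissible W
    W-admissible = merge-Admissible L L' L↑ L'↑

    V-admissible : Admissible V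
    V-admissible = recolour-Admissible W-admissible

    increasing : ∀ c → AllPairs _≺_ (select c V)
    increasing c = select-increasing c (Admissible⇒SameColour≺ V-admissible)

    length-Q : length Q ≡ length L
    length-Q = trans (recolour-count true W-admissible) (cong length (select-true-merge L L'))

    length-P : length P ≡ length L'
    length-P = trans (recolour-count false W-admissible) (cong length (select-false-merge L L'))

    exchange-↭ : Q ++ P ↭ L ++ L'
    exchange-↭ = begin
      Q ++ P                           ↭⟨ select-↭ V ⟩
      points V                         ≡⟨ points-recolour W ⟩
      points W                         ↭⟨ select-↭ W ⟨
      select true W ++ select false W  ≡⟨ cong₂ _++_ (select-true-merge L L') (select-false-merge L L') ⟩
      L ++ L'                          ∎
      where open PermutationReasoning

    All-exchange : ∀ {R : Pt → Set} → All R L → All R L' → All R Q × All R P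
    All-exchange RL RL' = AllP.++⁻ Q (↭P.All-resp-↭ (↭-sym exchange-↭) (AllP.++⁺ RL RL'))

    dinv-exchange : dinvSum Q P ≡ dinvSum L' L
    dinv-exchange = begin
      dinvSum Q P                                  ≡⟨ dinv-select true V V-admissible ⟩
      adjacentCross true V                         ≡⟨ recolour-cross W-admissible ⟩
      adjacentCross false W                        ≡⟨ dinv-select false W W-admissible ⟨
      dinvSum (select false W) (select true W)
        ≡⟨ cong₂ dinvSum (select-false-merge L L') (select-true-merge L L') ⟩
      dinvSum L' L                                 ∎
      where open ≡-Reasoning

    exchange-involutive : exchange Q P ≡ (L , L')
    exchange-involutive = begin
      exchange Q P                                             ≡⟨⟩
      (select true (recolour (merge Q P)) , select false (recolour (merge Q P)))
        ≡⟨ cong (λ U → select true (recolour U) , select false (recolour U))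
                (merge-select (Admissible⇒◁ V-admissible)) ⟩
      (select true (recolour V) , select false (recolour V))
        ≡⟨ cong (λ U → select true U , select false U) (recolour-involutive W) ⟩
      (select true W , select false W)
        ≡⟨ cong₂ _,_ (select-true-merge L L') (select-false-merge L L') ⟩
      (L , L') ∎
      where open ≡-Reasoning

    ↭-appended : ∀ A → Q ++ (P ++ A) ↭ L' ++ (L ++ A)
    ↭-appended A = begin
      Q ++ (P ++ A)   ≡⟨ ++-assoc Q P A ⟨
      (Q ++ P) ++ A   ↭⟨ ↭P.++⁺ʳ A exchange-↭ ⟩
      (L ++ L') ++ A  ≡⟨ ++-assoc L L' A ⟩
      L ++ (L' ++ A)  ↭⟨ ↭P.shifts L L' ⟩
      L' ++ (L ++ A)  ∎
      where open PermutationReasoning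

    ↭-appended-swapped : ∀ A → P ++ (Q ++ A) ↭ L' ++ (L ++ A)
    ↭-appended-swapped A = ↭-trans (↭P.shifts P Q) (↭-appended A)

    exponent-exchange : ∀ A → dinvSum L A + dinvSum L' (L ++ A) ≡ dinvSum P A + dinvSum Q (P ++ A)
    exponent-exchange A = begin
      dinvSum L A + dinvSum L' (L ++ A)                 ≡⟨ cong (dinvSum L A +_) (dinvSum-++ʳ L' L A) ⟩
      dinvSum L A + (dinvSum L' L + dinvSum L' A)       ≡⟨ x∙yz≈y∙xz (dinvSum L A) (dinvSum L' L) (dinvSum L' A) ⟩
      dinvSum L' L + (dinvSum L A + dinvSum L' A)       ≡⟨ cong₂ _+_ dinv-exchange colour-classes ⟨
      dinvSum Q P + (dinvSum Q A + dinvSum P A)         ≡⟨ x∙yz≈z∙xy (dinvSum Q P) (dinvSum Q A) (dinvSum P A) ⟩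
      dinvSum P A + (dinvSum Q P + dinvSum Q A)         ≡⟨ cong (dinvSum P A +_) (dinvSum-++ʳ Q P A) ⟨
      dinvSum P A + dinvSum Q (P ++ A)                  ∎
      where
      open ≡-Reasoning
      colour-classes : dinvSum Q A + dinvSum P A ≡ dinvSum L A + dinvSum L' A
      colour-classes = trans (sym (dinvSum-++ˡ Q P A)) (trans (dinvSum-↭ˡ A exchange-↭) (dinvSum-++ˡ L L' A))

    -- A chain meets column 0 at most once, and then at its head. Comparing the number of points in
    -- column 0 before and after the exchange, which preserves lengths, shows that each new chain
    -- starts in column 0 if it is non-empty.
    bar-exchange : T (firstOKᵇ bar L) → T (firstOKᵇ bar L') → T (firstOKᵇ bar Q) × T (firstOKᵇ bar P)
    bar-exchange barL barL' =
      headInColumn0⇒bar Q (+-tight (headInColumn0≤nonEmpty Q) (headInColumn0≤nonEmpty P) balance) ,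
      headInColumn0⇒bar P (+-tight (headInColumn0≤nonEmpty P) (headInColumn0≤nonEmpty Q)
                             (trans (+-comm (headInColumn0 P) _) (trans balance (+-comm (nonEmpty Q) _))))
      where
      open ≡-Reasoning
      balance : headInColumn0 Q + headInColumn0 P ≡ nonEmpty Q + nonEmpty P
      balance = begin
        headInColumn0 Q + headInColumn0 P
          ≡⟨ cong₂ _+_ (column0Count-increasing (increasing true)) (column0Count-increasing (increasing false)) ⟨
        column0Count Q + column0Count P             ≡⟨ column0Count-++ Q P ⟨
        column0Count (Q ++ P)                  ≡⟨ column0Count-↭ exchange-↭ ⟩
        column0Count (L ++ L')                 ≡⟨ column0Count-++ L L' ⟩
        column0Count L + column0Count L'            ≡⟨ cong₂ _+_ (column0Count-increasing L↑) (column0Count-increasing L'↑) ⟩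
        headInColumn0 L + headInColumn0 L'
          ≡⟨ cong₂ _+_ (bar⇒headInColumn0 L barL) (bar⇒headInColumn0 L' barL') ⟩
        nonEmpty L + nonEmpty L'
          ≡⟨ cong₂ _+_ (nonEmpty-length Q L length-Q) (nonEmpty-length P L' length-P) ⟨
        nonEmpty Q + nonEmpty P           ∎

    firstOK-exchange : ∀ κ′ → T (firstOKᵇ κ′ L) → T (firstOKᵇ κ′ L') → T (firstOKᵇ κ′ Q) × T (firstOKᵇ κ′ P)
    firstOK-exchange full _ _ = tt , tt
    firstOK-exchange bar barL barL' = bar-exchange barL barL'
    firstOK-exchange hat hatL hatL' =
      let (Q≥1 , P≥1) = All-exchange (hat⇒All-column≥1 L L↑ hatL) (hat⇒All-column≥1 L' L'↑ hatL')
      in All-column≥1⇒hat Q Q≥1 , All-column≥1⇒hat P P≥1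

    IsChain-exchange : IsChain κ Q × IsChain κ P
    IsChain-exchange =
      let (Q+ , P+) = All-exchange (IsChain.positive L-chain) (IsChain.positive L'-chain)
          (Qκ , Pκ) = firstOK-exchange κ (IsChain.firstOK L-chain) (IsChain.firstOK L'-chain)
      in record { positive = Q+ ; increasing = increasing true ; firstOK = Qκ } ,
         record { positive = P+ ; increasing = increasing false ; firstOK = Pκ }

  -- Enumerating chains

  count-↭ : ∀ x {X X'} → X ↭ X' → count x X ≡ count x X'
  count-↭ x X↭X' = ↭P.↭-length (↭P.filter-↭ (x ≟Pt_) X↭X')

  all-↭ : {A : Set} (f : A → Bool) → ∀ {xs ys} → xs ↭ ys → all f xs ≡ all f ys
  all-↭ f xs↭ys = ⇔→≡ {z = true} (mk⇔ (transport xs↭ys) (transport (↭-sym xs↭ys)))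
    where
    transport : ∀ {xs ys} → xs ↭ ys → all f xs ≡ true → all f ys ≡ true
    transport xs↭ys =
      Equivalence.to T-≡ ∘ AllP.all⁻ f ∘ ↭P.All-resp-↭ xs↭ys ∘ AllP.all⁺ f _ ∘ Equivalence.from T-≡

  bagEqᵇ-↭ : ∀ {X X'} B → X ↭ X' → bagEqᵇ X B ≡ bagEqᵇ X' B
  bagEqᵇ-↭ {X} B X↭X' =
    trans (cong and (map-cong (λ z → cong (_≡ᵇ count z B) (count-↭ z X↭X')) (X ++ B)))
          (all-↭ _ (↭P.++⁺ʳ B X↭X'))

  module _ (P : List Pt) where

    private
      extendAll : ℕ → List Pt → List (List Pt)
      extendAll k xs = concatMap (λ x → map (x ∷_) (listsOfLength k P)) xs

      ∈-extendAll⁻ : ∀ k xs {l} → l ∈ extendAll k xs →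
        ∃ λ x → ∃ λ l′ → x ∈ xs × l′ ∈ listsOfLength k P × l ≡ x ∷ l′
      ∈-extendAll⁻ k (x ∷ xs) l∈ with ∈-++⁻ (map (x ∷_) (listsOfLength k P)) l∈
      ... | inj₁ l∈x∷ = let (l′ , l′∈ , eq) = ∈-map⁻ (x ∷_) l∈x∷ in x , l′ , here refl , l′∈ , eq
      ... | inj₂ l∈rest =
        let (y , l′ , y∈ , l′∈ , eq) = ∈-extendAll⁻ k xs l∈rest in y , l′ , there y∈ , l′∈ , eq

      ∈-extendAll⁺ : ∀ k xs {x l′} → x ∈ xs → l′ ∈ listsOfLength k P → (x ∷ l′) ∈ extendAll k xs
      ∈-extendAll⁺ k (y ∷ xs) (here refl) l′∈ = ∈-++⁺ˡ (∈-map⁺ (y ∷_) l′∈)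
      ∈-extendAll⁺ k (y ∷ xs) (there x∈) l′∈ =
        ∈-++⁺ʳ (map (y ∷_) (listsOfLength k P)) (∈-extendAll⁺ k xs x∈ l′∈)

      extendAll-unique : ∀ k xs → Unique xs → Unique (listsOfLength k P) → Unique (extendAll k xs)
      extendAll-unique k [] _ _ = []
      extendAll-unique k (x ∷ xs) (x∉xs ∷ xs!) ls! =
        Unique.++⁺ (Unique.map⁺ ∷-injectiveʳ ls!) (extendAll-unique k xs xs! ls!) disjoint
        where
        disjoint : Disjoint (map (x ∷_) (listsOfLength k P)) (extendAll k xs)
        disjoint (l∈x∷ , l∈rest) with ∈-map⁻ (x ∷_) l∈x∷ | ∈-extendAll⁻ k xs l∈rest
        ... | _ , _ , refl | y , _ , y∈ , _ , eq =
          AllP.All¬⇒¬Any x∉xs (subst (_∈ xs) (sym (proj₁ (∷-injective eq))) y∈)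

    listsOfLength-unique : ∀ k → Unique P → Unique (listsOfLength k P)
    listsOfLength-unique zero _ = [] ∷ []
    listsOfLength-unique (suc k) P! = extendAll-unique k P P! (listsOfLength-unique k P!)

    ∈-listsOfLength⁻ : ∀ k {l} → l ∈ listsOfLength k P → length l ≡ k × All (_∈ P) l
    ∈-listsOfLength⁻ zero (here refl) = refl , []
    ∈-listsOfLength⁻ (suc k) l∈ with ∈-extendAll⁻ k P l∈
    ... | x , l′ , x∈ , l′∈ , refl = let (len , all) = ∈-listsOfLength⁻ k l′∈ in cong suc len , x∈ ∷ all

    ∈-listsOfLength⁺ : ∀ k l → length l ≡ k → All (_∈ P) l → l ∈ listsOfLength k P
    ∈-listsOfLength⁺ zero [] refl [] = here refl
    ∈-listsOfLength⁺ (suc k) (x ∷ l) len (x∈ ∷ l⊆) =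
      ∈-extendAll⁺ k P x∈ (∈-listsOfLength⁺ k l (suc-injective len) l⊆)

  box-unique : ∀ B → Unique (box B)
  box-unique B = Unique.cartesianProduct⁺ (Unique.upTo⁺ (suc (bound B))) (Unique.upTo⁺ (suc (bound B)))

  chainsIn-unique : ∀ κ k B → Unique (chainsIn κ (ℤ.+ k) B)
  chainsIn-unique κ k B =
    Unique.filter⁺ (λ L → T? (isChainᵇ κ L)) (listsOfLength-unique (box B) k (box-unique B))

  ∈-chainsIn⁻ : ∀ κ k B {L} → L ∈ chainsIn κ (ℤ.+ k) B → length L ≡ k × All (_∈ box B) L × IsChain κ L
  ∈-chainsIn⁻ κ k B L∈ =
    let (L∈lists , chain) = ∈-filter⁻ (λ L → T? (isChainᵇ κ L)) {xs = listsOfLength k (box B)} L∈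
        (len , inBox) = ∈-listsOfLength⁻ (box B) k L∈lists
    in len , inBox , isChainᵇ⇒IsChain κ _ chain

  ∈-chainsIn⁺ : ∀ κ k B {L} → length L ≡ k → All (_∈ box B) L → IsChain κ L → L ∈ chainsIn κ (ℤ.+ k) B
  ∈-chainsIn⁺ κ k B {L} len inBox chain =
    ∈-filter⁺ (λ L → T? (isChainᵇ κ L)) (∈-listsOfLength⁺ (box B) k L len inBox) (IsChain⇒isChainᵇ chain)

  AllPairs-map-∈ : {X : Set} {R S : X → X → Set} {xs : List X} → AllPairs R xs →
    (∀ {a b} → a ∈ xs → b ∈ xs → R a b → S a b) → AllPairs S xs
  AllPairs-map-∈ [] f = []
  AllPairs-map-∈ (Rx ∷ Rxs) f =
    All-map-∈ Rx (λ b∈ → f (here refl) (there b∈)) ∷ AllPairs-map-∈ Rxs (λ a∈ b∈ → f (there a∈) (there b∈))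
    where
    All-map-∈ : ∀ {P Q : _ → Set} {ys} → All P ys → (∀ {b} → b ∈ ys → P b → Q b) → All Q ys
    All-map-∈ [] g = []
    All-map-∈ (p ∷ ps) g = g (here refl) p ∷ All-map-∈ ps (g ∘ there)

module Coefficients {c ℓ : Level} (R : CommutativeRing c ℓ) (q : CommutativeRing.Carrier R) where

  open import Data.Bool using (Bool; true; false; T; if_then_else_)
  open import Data.Bool.Properties using (T-≡)
  open import Data.Empty using (⊥-elim)
  import Data.Integer as ℤ
  open import Data.List using (_∷_; []; _++_; map; filter; cartesianProduct)
  open import Data.List.Properties using (map-∘)
  open import Data.List.Membership.Propositional using (_∈_)
  open import Data.List.Membership.Propositional.Properties
    using (∈-map⁺; ∈-map⁻; ∈-filter⁺; ∈-filter⁻; ∈-cartesianProduct⁺; ∈-cartesianProduct⁻)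
  open import Data.List.Membership.Propositional.Properties.WithK using (unique∧set⇒bag)
  open import Data.List.Relation.Binary.BagAndSetEquality using (∼bag⇒↭)
  open import Data.List.Relation.Binary.Permutation.Propositional using (_↭_; ↭⇒↭ₛ′)
  import Data.List.Relation.Binary.Permutation.Propositional.Properties as ↭P
  open import Data.List.Relation.Binary.Permutation.Setoid.Properties using (foldr-commMonoid)
  import Data.List.Relation.Unary.AllPairs.Properties as AllPairs
  open import Data.List.Relation.Unary.Any using (here; there)
  open import Data.List.Relation.Unary.Unique.Propositional using (Unique)
  import Data.List.Relation.Unary.Unique.Propositional.Properties as Unique
  open import Data.Nat using (ℕ; zero; suc)
  import Data.Nat as ℕ
  open import Data.Product using (_×_; _,_; proj₁; uncurry)
  open import Function using (_∘_)
  open import Function.Bundles using (Equivalence; mk⇔)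
  import Relation.Binary.PropositionalEquality as ≡
  open ≡ using (_≡_)
  open import Relation.Nullary using (¬_)
  open import Relation.Nullary.Decidable using (T?)

  open Combinatorics
  open CommutativeRing R renaming (refl to ≈-refl; sym to ≈-sym; trans to ≈-trans)
  open import Algebra.Properties.CommutativeSemigroup +-commutativeSemigroup using (interchange)
  open import Relation.Binary.Reasoning.Setoid setoid
  open Operators R q

  sumR-↭ : ∀ {xs ys} → xs ↭ ys → sumR xs ≈ sumR ys
  sumR-↭ xs↭ys = foldr-commMonoid setoid +-isCommutativeMonoid (↭⇒↭ₛ′ isEquivalence xs↭ys)

  sumR-cong : ∀ {X : Set} (f g : X → Carrier) xs → (∀ {x} → x ∈ xs → f x ≈ g x) →
    sumR (map f xs) ≈ sumR (map g xs)
  sumR-cong f g [] _ = ≈-refl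
  sumR-cong f g (x ∷ xs) f≈g = +-cong (f≈g (here ≡.refl)) (sumR-cong f g xs (f≈g ∘ there))

  sumR-zero : ∀ {X : Set} (f : X → Carrier) xs → (∀ {x} → x ∈ xs → f x ≈ 0#) → sumR (map f xs) ≈ 0#
  sumR-zero f [] _ = ≈-refl
  sumR-zero f (x ∷ xs) f≈0 =
    ≈-trans (+-cong (f≈0 (here ≡.refl)) (sumR-zero f xs (f≈0 ∘ there))) (+-identityˡ 0#)

  sumR-filter : ∀ {X : Set} (s : X → Bool) (f : X → Carrier) xs → (∀ {x} → x ∈ xs → ¬ T (s x) → f x ≈ 0#) →
    sumR (map f xs) ≈ sumR (map f (filter (T? ∘ s) xs))
  sumR-filter s f [] _ = ≈-refl
  sumR-filter s f (x ∷ xs) off≈0 with s x in sx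
  ... | true = +-congˡ (sumR-filter s f xs (off≈0 ∘ there))
  ... | false = ≈-trans (+-cong (off≈0 (here ≡.refl) (≡.subst T sx)) (sumR-filter s f xs (off≈0 ∘ there)))
                        (+-identityˡ _)

  sumR-++ : ∀ {X : Set} (f : X → Carrier) xs ys → sumR (map f (xs ++ ys)) ≈ sumR (map f xs) + sumR (map f ys)
  sumR-++ f [] ys = ≈-sym (+-identityˡ _)
  sumR-++ f (x ∷ xs) ys = ≈-trans (+-congˡ (sumR-++ f xs ys)) (≈-sym (+-assoc (f x) _ _))

  sumR-+ : ∀ {X : Set} (f g : X → Carrier) xs →
    sumR (map (λ x → f x + g x) xs) ≈ sumR (map f xs) + sumR (map g xs)
  sumR-+ f g [] = ≈-sym (+-identityˡ 0#)
  sumR-+ f g (x ∷ xs) = begin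
    (f x + g x) + sumR (map (λ x → f x + g x) xs)     ≈⟨ +-congˡ (sumR-+ f g xs) ⟩
    (f x + g x) + (sumR (map f xs) + sumR (map g xs)) ≈⟨ interchange (f x) (g x) _ _ ⟩
    (f x + sumR (map f xs)) + (g x + sumR (map g xs)) ∎

  *-sumR : ∀ {X : Set} x (f : X → Carrier) xs → x * sumR (map f xs) ≈ sumR (map (λ y → x * f y) xs)
  *-sumR x f [] = zeroʳ x
  *-sumR x f (y ∷ xs) = ≈-trans (distribˡ x (f y) _) (+-congˡ (*-sumR x f xs))

  sumR-swap : ∀ {X Y : Set} (f : X → Y → Carrier) xs ys →
    sumR (map (λ x → sumR (map (f x) ys)) xs) ≈ sumR (map (λ y → sumR (map (λ x → f x y) xs)) ys)
  sumR-swap f [] ys = ≈-sym (sumR-zero _ ys (λ _ → ≈-refl))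
  sumR-swap f (x ∷ xs) ys = ≈-trans (+-congˡ (sumR-swap f xs ys)) (≈-sym (sumR-+ (f x) _ ys))

  sumR-cartesianProduct : ∀ {X Y : Set} (f : X → Y → Carrier) xs ys →
    sumR (map (λ x → sumR (map (f x) ys)) xs) ≈ sumR (map (uncurry f) (cartesianProduct xs ys))
  sumR-cartesianProduct f [] ys = ≈-refl
  sumR-cartesianProduct f (x ∷ xs) ys = ≈-sym (begin
    sumR (map (uncurry f) (map (x ,_) ys ++ cartesianProduct xs ys))
      ≈⟨ sumR-++ (uncurry f) (map (x ,_) ys) _ ⟩
    sumR (map (uncurry f) (map (x ,_) ys)) + sumR (map (uncurry f) (cartesianProduct xs ys))
      ≡⟨ ≡.cong (λ s → sumR s + _) (≡.sym (map-∘ ys)) ⟩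
    sumR (map (f x) ys) + sumR (map (uncurry f) (cartesianProduct xs ys))
      ≈⟨ +-congˡ (sumR-cartesianProduct f xs ys) ⟨
    sumR (map (f x) ys) + sumR (map (λ x → sumR (map (f x) ys)) xs) ∎)

  sumR-involution : ∀ {X : Set} (zs : List X) (s : X → Bool) (φ : X → X) (F G : X → Carrier) → Unique zs →
    (∀ {z} → z ∈ zs → T (s z) → φ z ∈ zs × T (s (φ z)) × φ (φ z) ≡ z × F z ≈ G (φ z)) →
    (∀ {z} → z ∈ zs → ¬ T (s z) → F z ≈ 0# × G z ≈ 0#) →
    sumR (map F zs) ≈ sumR (map G zs)
  sumR-involution zs s φ F G zs! involution vanish = begin
    sumR (map F zs)        ≈⟨ sumR-filter s F zs (λ z∈ ¬sz → proj₁ (vanish z∈ ¬sz)) ⟩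
    sumR (map F ys)        ≈⟨ sumR-cong F (G ∘ φ) ys (λ z∈ → proj₂ (proj₂ (proj₂ (inv z∈)))) ⟩
    sumR (map (G ∘ φ) ys)  ≡⟨ ≡.cong sumR (map-∘ ys) ⟩
    sumR (map G (map φ ys)) ≈⟨ sumR-↭ (↭P.map⁺ G φys↭ys) ⟩
    sumR (map G ys)        ≈⟨ sumR-filter s G zs (λ z∈ ¬sz → proj₂ (vanish z∈ ¬sz)) ⟨
    sumR (map G zs)        ∎
    where
    ys = filter (T? ∘ s) zs
    inv : ∀ {z} → z ∈ ys → φ z ∈ zs × T (s (φ z)) × φ (φ z) ≡ z × F z ≈ G (φ z)
    inv z∈ = let (z∈zs , sz) = ∈-filter⁻ (T? ∘ s) {xs = zs} z∈ in involution z∈zs sz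
    φ∈ys : ∀ {z} → z ∈ ys → φ z ∈ ys
    φ∈ys z∈ = ∈-filter⁺ (T? ∘ s) (proj₁ (inv z∈)) (proj₁ (proj₂ (inv z∈)))
    ys! : Unique ys
    ys! = Unique.filter⁺ (T? ∘ s) zs!
    φys! : Unique (map φ ys)
    φys! = AllPairs.map⁺ (AllPairs-map-∈ ys! (λ a∈ b∈ a≢b φa≡φb →
      a≢b (≡.trans (≡.sym (proj₁ (proj₂ (proj₂ (inv a∈)))))
                   (≡.trans (≡.cong φ φa≡φb) (proj₁ (proj₂ (proj₂ (inv b∈))))))))
    φys↭ys : map φ ys ↭ ys
    φys↭ys = ∼bag⇒↭ (unique∧set⇒bag φys! ys! (mk⇔
      (λ z∈ → let (y , y∈ , z≡φy) = ∈-map⁻ φ z∈ in ≡.subst (_∈ ys) (≡.sym z≡φy) (φ∈ys y∈))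
      (λ z∈ → ≡.subst (_∈ map φ ys) (proj₁ (proj₂ (proj₂ (inv z∈)))) (∈-map⁺ φ (φ∈ys z∈)))))

  qpow-+ : ∀ a b → qpow (a ℕ.+ b) ≈ qpow a * qpow b
  qpow-+ zero b = ≈-sym (*-identityˡ (qpow b))
  qpow-+ (suc a) b = ≈-trans (*-congˡ (qpow-+ a b)) (≈-sym (*-assoc q (qpow a) (qpow b)))

  module _ (κ : Kind) (A B : List Pt) where

    pairTerm : List Pt → List Pt → Carrier
    pairTerm L L' = if bagEqᵇ (L' ++ (L ++ A)) B then qpow (dinv L A ℕ.+ dinv L' (L ++ A)) else 0#

    hhCoeff-pairTerms : ∀ m n →
      hhCoeff κ n m A B ≈ sumR (map (λ L → sumR (map (pairTerm L) (chainsIn κ n B))) (chainsIn κ m B))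
    hhCoeff-pairTerms m n = sumR-cong _ _ (chainsIn κ m B) λ {L} _ →
      ≈-trans (*-sumR (qpow (dinv L A)) _ (chainsIn κ n B))
              (sumR-cong _ _ (chainsIn κ n B) λ {L'} _ → term L L')
      where
      term : ∀ L L' → qpow (dinv L A) * (if bagEqᵇ (L' ++ (L ++ A)) B then qpow (dinv L' (L ++ A)) else 0#)
                      ≈ pairTerm L L'
      term L L' with bagEqᵇ (L' ++ (L ++ A)) B
      ... | true = ≈-sym (qpow-+ (dinv L A) (dinv L' (L ++ A)))
      ... | false = zeroʳ _

    inSupport : List Pt × List Pt → Bool
    inSupport (L , L') = bagEqᵇ (L' ++ (L ++ A)) B

    if-false : ∀ {b : Bool} {x : Carrier} → ¬ T b → (if b then x else 0#) ≈ 0#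
    if-false {false} _ = ≈-refl
    if-false {true} ¬t = ⊥-elim (¬t _)

    module _ (m n : ℕ) where

      Cm = chainsIn κ (ℤ.+ m) B
      Cn = chainsIn κ (ℤ.+ n) B

      off-support : ∀ {z} → z ∈ cartesianProduct Cm Cn → ¬ T (inSupport z) →
        uncurry pairTerm z ≈ 0# × uncurry (λ Q P → pairTerm P Q) z ≈ 0#
      off-support {L , L'} _ ¬s =
        if-false ¬s , if-false (¬s ∘ ≡.subst T (bagEqᵇ-↭ B (↭P.shifts L L')))

      exchange-pairs : ∀ {z} → z ∈ cartesianProduct Cm Cn → T (inSupport z) →
        uncurry exchange z ∈ cartesianProduct Cm Cn × T (inSupport (uncurry exchange z)) ×
        uncurry exchange (uncurry exchange z) ≡ z ×
        uncurry pairTerm z ≈ uncurry (λ Q P → pairTerm P Q) (uncurry exchange z)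
      exchange-pairs {L , L'} z∈ s with ∈-cartesianProduct⁻ Cm Cn z∈
      ... | L∈ , L'∈ with ∈-chainsIn⁻ κ m B L∈ | ∈-chainsIn⁻ κ n B L'∈
      ... | lenL , L⊆box , L-chain | lenL' , L'⊆box , L'-chain =
        ∈-cartesianProduct⁺ (∈-chainsIn⁺ κ m B (≡.trans length-Q lenL) (proj₁ inBox) (proj₁ IsChain-exchange))
                            (∈-chainsIn⁺ κ n B (≡.trans length-P lenL') (proj₂ inBox) (proj₂ IsChain-exchange)) ,
        Equivalence.from T-≡ (≡.trans (bagEqᵇ-↭ B (↭-appended-swapped A)) (Equivalence.to T-≡ s)) ,
        exchange-involutive ,
        reflexive (≡.cong₂ (λ b e → if b then qpow e else 0#)
                           (≡.sym (bagEqᵇ-↭ B (↭-appended A))) (exponent-exchange A))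
        where
        open Exchange L-chain L'-chain
        inBox = All-exchange L⊆box L'⊆box

      Cm×Cn-unique : Unique (cartesianProduct Cm Cn)
      Cm×Cn-unique = Unique.cartesianProduct⁺ (chainsIn-unique κ m B) (chainsIn-unique κ n B)

      hhCoeff-commute-ℕ : hhCoeff κ (ℤ.+ n) (ℤ.+ m) A B ≈ hhCoeff κ (ℤ.+ m) (ℤ.+ n) A B
      hhCoeff-commute-ℕ = begin
        hhCoeff κ (ℤ.+ n) (ℤ.+ m) A B                           ≈⟨ hhCoeff-pairTerms (ℤ.+ m) (ℤ.+ n) ⟩
        sumR (map (λ L → sumR (map (pairTerm L) Cn)) Cm)        ≈⟨ sumR-cartesianProduct pairTerm Cm Cn ⟩
        sumR (map (uncurry pairTerm) (cartesianProduct Cm Cn))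
          ≈⟨ sumR-involution _ inSupport (uncurry exchange) _ _ Cm×Cn-unique exchange-pairs off-support ⟩
        sumR (map (uncurry (λ Q P → pairTerm P Q)) (cartesianProduct Cm Cn))
          ≈⟨ sumR-cartesianProduct (λ Q P → pairTerm P Q) Cm Cn ⟨
        sumR (map (λ Q → sumR (map (λ P → pairTerm P Q) Cn)) Cm) ≈⟨ sumR-swap pairTerm Cn Cm ⟨
        sumR (map (λ P → sumR (map (pairTerm P) Cm)) Cn)        ≈⟨ hhCoeff-pairTerms (ℤ.+ n) (ℤ.+ m) ⟨
        hhCoeff κ (ℤ.+ m) (ℤ.+ n) A B                           ∎

    hhCoeff-commute : ∀ n m → hhCoeff κ n m A B ≈ hhCoeff κ m n A B
    hhCoeff-commute (ℤ.+ n) (ℤ.+ m) = hhCoeff-commute-ℕ m n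
    hhCoeff-commute ℤ.-[1+ _ ] m = sumR-zero _ (chainsIn κ m B) (λ _ → zeroʳ _)
    hhCoeff-commute (ℤ.+ n) ℤ.-[1+ _ ] = ≈-sym (sumR-zero _ (chainsIn κ (ℤ.+ n) B) (λ _ → zeroʳ _))

corollary4p5 : {c ℓ : Level} (R : CommutativeRing c ℓ) (q : CommutativeRing.Carrier R)
    (κ : Kind) (n m : ℤ) (A B : List Pt) →
    All (λ p → 1 ≤ proj₂ p) A → All (λ p → 1 ≤ proj₂ p) B →
    CommutativeRing._≈_ R (Operators.hhCoeff R q κ n m A B) (Operators.hhCoeff R q κ m n A B)
corollary4p5 R q κ n m A B _ _ = Coefficients.hhCoeff-commute R q κ A B n m
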